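{- Let $p_n$ denote the $n$th prime ($p_1 = 2$, $p_2 = 3, \ldots$), and let \[ f_1 = \sum_{k=1}^{\infty} \frac{p_k - 1}{\prod_{i=1}^{k-1} p_i} = 2.920050977316\ldots \] (where the empty product for $k=1$ equals $1$). Then $f_1$ is irrational.
   Context: This $f_1$ is the prime-generating constant: with $f_n = \lfloor f_{n-1} \rfloor ( f_{n-1} - \lfloor f_{n-1} \rfloor + 1 )$ for $n \geq 2$, one has $\lfloor f_n \rfloor = p_n$ for all $n$. -}

module Defs where

open import Data.Nat using (ℕ; zero; suc; _*_; _∸_; _<_)
open import Data.Nat.Primality using (Prime)
open import Data.Integer using (+_)
open import Data.Rational using (ℚ; _/_; 0ℚ; _+_)
open import Data.Product using (∃; _×_)
open import Relation.Binary.PropositionalEquality using (_≡_)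

-- p is the enumeration of the primes in increasing order, 0-indexed:
-- p 0 = 2, p 1 = 3, ...  (so the paper's p_n is p (n - 1)).
IsPrimeEnumeration : (ℕ → ℕ) → Set
IsPrimeEnumeration p =
  (∀ n → Prime (p n)) × ((∀ m n → m < n → p m < p n) × (∀ q → Prime q → ∃ λ n → p n ≡ q))

-- a / d as a rational; only ever used with d > 0 (the d = 0 clause is a dummy).
frac : ℕ → ℕ → ℚ
frac a zero    = 0ℚ
frac a (suc d) = (+ a) / suc d

primorialP : (ℕ → ℕ) → ℕ → ℕ
primorialP p zero    = 1
primorialP p (suc k) = primorialP p k * p k

-- partial sum  S p N = Σ_{k < N} (p k - 1) / ∏_{i < k} p i
-- (paper's terms k = 1 .. N, shifted to 0-indexing)
partialSum : (ℕ → ℕ) → ℕ → ℚ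
partialSum p zero    = 0ℚ
partialSum p (suc N) = partialSum p N + frac (p N ∸ 1) (primorialP p N)

module Submission where

-- Write q = a / b and S M = I M / P M for the partial sums, P M = p 0 ⋯ p (M - 1). Then
-- Z M = a P M - b I M = b P M (q - S M) is a natural number with Z (M + 1) = p M (Z M - b (p M - 1)),
-- and W M = Z M - b p M satisfies W M ≥ 1 and W (M + 1) + b p (M + 1) = p M W M + b p M.
-- As p (k + 1) ≤ 8 p k for large k, a value W k > 7b would make W M grow like P M / P k, keeping
-- q - S M ≥ 1 / (2 b P k) for ever; so eventually W ≤ 7b, which forces p (k + 1) ≥ (1 + 1/2b) p k.
-- That contradicts Erdős's bound on the central binomial coefficient, which shows that the
-- number of primes in (n, 2n] is unbounded.

open import Defs

module NumberTheory where

  open import Data.Nat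
  open import Data.Nat.Properties
  open import Data.Nat.Combinatorics
    using (_C_; nCk≡n!/k![n-k]!; k![n∸k]!∣n!; nCk≡nC[n∸k]; nCk+nC[k+1]≡[n+1]C[k+1])
  open import Data.Nat.Divisibility
  open import Data.Nat.Primality
  open import Data.Nat.Induction using (<-rec)
  open import Data.Nat.DivMod
  open import Data.Nat.Tactic.RingSolver
  open import Data.List using (_∷_; [])
  import Data.List.Relation.Unary.All as All
  open import Data.Nat.ListAction using (product)
  open import Data.Nat.Primality.Factorisation using (factorise)
  open import Data.Product
  open import Data.Sum using (_⊎_; inj₁; inj₂; [_,_]′)
  open import Data.Empty using (⊥; ⊥-elim)
  open import Relation.Unary using (Pred; Decidable)
  open import Level using (0ℓ)
  open import Relation.Nullary
  open import Relation.Nullary.Decidable using (_×-dec_)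
  open import Relation.Binary.PropositionalEquality
  open import Function using (id)
  open import Algebra.Properties.CommutativeSemigroup *-commutativeSemigroup using (x∙yz≈y∙xz)

  m/n≡k : ∀ {m n k} .{{_ : NonZero n}} → k * n ≤ m → m < suc k * n → m / n ≡ k
  m/n≡k {m} {n} {k} k*n≤m m<[1+k]*n = ≤-antisym
    (≤-pred (m<n*o⇒m/o<n m<[1+k]*n))
    (subst (_≤ m / n) (m*n/n≡m k n) (/-monoˡ-≤ n k*n≤m))

  m<[1+m/n]*n : ∀ m n .{{_ : NonZero n}} → m < suc (m / n) * n
  m<[1+m/n]*n m n = subst (_< n + m / n * n) (sym (m≡m%n+[m/n]*n m n)) (+-monoˡ-< (m / n * n) (m%n<n m n))

  [m+n+δ]/d≡m/d+n/d+carry : ∀ m n δ d .{{_ : NonZero d}} → δ ≤ 1 →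
    ∃ λ carry → carry ≤ 1 × (m + n + δ) / d ≡ m / d + n / d + carry
  [m+n+δ]/d≡m/d+n/d+carry m n δ d δ≤1 =
    (m + n + δ) / d ∸ q , ≤-trans (∸-monoˡ-≤ q upper) (≤-reflexive (m+n∸m≡n q 1)) ,
    sym (m+[n∸m]≡n lower)
    where
    q = m / d + n / d
    lower : q ≤ (m + n + δ) / d
    lower = subst (_≤ (m + n + δ) / d) (m*n/n≡m q d) (/-monoˡ-≤ d (begin
      q * d                 ≡⟨ *-distribʳ-+ d (m / d) (n / d) ⟩
      m / d * d + n / d * d ≤⟨ +-mono-≤ (m/n*n≤m m d) (m/n*n≤m n d) ⟩
      m + n                 ≤⟨ m≤m+n (m + n) δ ⟩
      m + n + δ             ∎))
      where open ≤-Reasoning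
    upper : (m + n + δ) / d ≤ q + 1
    upper = ≤-trans (≤-pred (m<n*o⇒m/o<n (begin-strict
      m + n + δ                           ≤⟨ +-monoʳ-≤ (m + n) δ≤1 ⟩
      m + n + 1                           ≡⟨ +-comm (m + n) 1 ⟩
      suc m + n                           <⟨ +-mono-≤-< (m<[1+m/n]*n m d) (m<[1+m/n]*n n d) ⟩
      suc (m / d) * d + suc (n / d) * d   ≡⟨ *-distribʳ-+ d (suc (m / d)) (suc (n / d)) ⟨
      (suc (m / d) + suc (n / d)) * d     ∎)))
      (≤-reflexive (trans (+-suc (m / d) (n / d)) (+-comm 1 q)))
      where open ≤-Reasoning

  -- Central binomial coefficients

  nCk*k!*[n∸k]!≡n! : ∀ {n k} → k ≤ n → (n C k) * (k ! * (n ∸ k) !) ≡ n !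
  nCk*k!*[n∸k]!≡n! {n} {k} k≤n =
    trans (cong (_* (k ! * (n ∸ k) !)) (nCk≡n!/k![n-k]! k≤n))
          (m/n*n≡m {{k !* (n ∸ k) !≢0}} (k![n∸k]!∣n! k≤n))

  nCk>0 : ∀ {n k} → k ≤ n → 0 < n C k
  nCk>0 {n} {k} k≤n = >-nonZero⁻¹ (n C k) {{m*n≢0⇒m≢0 (n C k) {{nCk*k!*[n∸k]!≢0}}}}
    where
    nCk*k!*[n∸k]!≢0 : NonZero ((n C k) * (k ! * (n ∸ k) !))
    nCk*k!*[n∸k]!≢0 = subst NonZero (sym (nCk*k!*[n∸k]!≡n! k≤n)) (n !≢0)

  centralBinom : ℕ → ℕ
  centralBinom n = (n + n) C n

  centralBinom*n!*n!≡[2n]! : ∀ n → centralBinom n * (n ! * n !) ≡ (n + n) !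
  centralBinom*n!*n!≡[2n]! n =
    subst (λ m → centralBinom n * (n ! * m !) ≡ (n + n) !) (m+n∸m≡n n n)
          (nCk*k!*[n∸k]!≡n! (m≤m+n n n))

  centralBinom>0 : ∀ n → 0 < centralBinom n
  centralBinom>0 n = nCk>0 (m≤m+n n n)

  centralBinom-rec : ∀ n → suc n * centralBinom (suc n) ≡ 2 * (1 + n + n) * centralBinom n
  centralBinom-rec n = *-cancelʳ-≡ _ _ (n ! * n ! * suc n) {{m*n≢0 _ _ {{n !* n !≢0}}}} (begin
    suc n * B (suc n) * (n ! * n ! * suc n)         ≡⟨ regroup₁ (B (suc n)) n (n !) ⟩
    B (suc n) * (suc n ! * suc n !)                 ≡⟨ centralBinom*n!*n!≡[2n]! (suc n) ⟩
    (suc n + suc n) !                               ≡⟨ cong (λ m → suc m !) (+-suc n n) ⟩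
    (2 + n + n) * ((1 + n + n) * (n + n) !)         ≡⟨ cong (λ m → (2 + n + n) * ((1 + n + n) * m)) (centralBinom*n!*n!≡[2n]! n) ⟨
    (2 + n + n) * ((1 + n + n) * (B n * (n ! * n !))) ≡⟨ regroup₂ (B n) n (n !) ⟩
    2 * (1 + n + n) * B n * (n ! * n ! * suc n)     ∎)
    where
    open ≡-Reasoning
    B = centralBinom
    regroup₁ : ∀ b n f → suc n * b * (f * f * suc n) ≡ b * ((suc n * f) * (suc n * f))
    regroup₁ = solve-∀
    regroup₂ : ∀ b n f → (2 + n + n) * ((1 + n + n) * (b * (f * f))) ≡ 2 * (1 + n + n) * b * (f * f * suc n)
    regroup₂ = solve-∀

  4^n≤[2n+1]*centralBinom : ∀ n → 4 ^ n ≤ (1 + n + n) * centralBinom n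
  4^n≤[2n+1]*centralBinom zero    = ≤-refl
  4^n≤[2n+1]*centralBinom (suc n) = *-cancelˡ-≤ (suc n) (begin
    suc n * (4 * 4 ^ n)                       ≡⟨ x*[4*y]≡4*x*y (suc n) (4 ^ n) ⟩
    4 * suc n * 4 ^ n                         ≤⟨ *-monoʳ-≤ (4 * suc n) (4^n≤[2n+1]*centralBinom n) ⟩
    4 * suc n * ((1 + n + n) * B n)           ≤⟨ 4[n+1][2n+1]≤[2n+3]*2[2n+1] n (B n) ⟩
    (1 + suc n + suc n) * (2 * (1 + n + n) * B n) ≡⟨ cong ((1 + suc n + suc n) *_) (centralBinom-rec n) ⟨
    (1 + suc n + suc n) * (suc n * B (suc n)) ≡⟨ x∙yz≈y∙xz (1 + suc n + suc n) (suc n) (B (suc n)) ⟩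
    suc n * ((1 + suc n + suc n) * B (suc n)) ∎)
    where
    open ≤-Reasoning
    B = centralBinom
    x*[4*y]≡4*x*y : ∀ x y → x * (4 * y) ≡ 4 * x * y
    x*[4*y]≡4*x*y = solve-∀
    4[n+1][2n+1]≤[2n+3]*2[2n+1] : ∀ n b → 4 * suc n * ((1 + n + n) * b) ≤ (1 + suc n + suc n) * (2 * (1 + n + n) * b)
    4[n+1][2n+1]≤[2n+3]*2[2n+1] n b = begin
      4 * suc n * ((1 + n + n) * b)                         ≤⟨ m≤m+n _ (2 * (1 + n + n) * b) ⟩
      4 * suc n * ((1 + n + n) * b) + 2 * (1 + n + n) * b   ≡⟨ solve (n ∷ b ∷ []) ⟩
      (1 + suc n + suc n) * (2 * (1 + n + n) * b)           ∎

  centralBinom-suc≤4*centralBinom : ∀ n → centralBinom (suc n) ≤ 4 * centralBinom n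
  centralBinom-suc≤4*centralBinom n = *-cancelˡ-≤ (suc n) (begin
    suc n * centralBinom (suc n)           ≡⟨ centralBinom-rec n ⟩
    2 * (1 + n + n) * centralBinom n       ≤⟨ *-monoˡ-≤ (centralBinom n) (*-monoʳ-≤ 2 (n≤1+n (1 + n + n))) ⟩
    2 * (2 + n + n) * centralBinom n       ≡⟨ 2[2n+2]≡[n+1]*4 n (centralBinom n) ⟩
    suc n * (4 * centralBinom n)           ∎)
    where
    open ≤-Reasoning
    2[2n+2]≡[n+1]*4 : ∀ n b → 2 * (2 + n + n) * b ≡ suc n * (4 * b)
    2[2n+2]≡[n+1]*4 n b = solve (n ∷ b ∷ [])

  centralBinom-suc≡2*[2n+1]Cn : ∀ n → centralBinom (suc n) ≡ 2 * (suc (n + n) C n)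
  centralBinom-suc≡2*[2n+1]Cn n = begin
    suc (n + suc n) C suc n                             ≡⟨ cong (λ m → suc m C suc n) (+-suc n n) ⟩
    suc (suc (n + n)) C suc n                           ≡⟨ nCk+nC[k+1]≡[n+1]C[k+1] (suc (n + n)) n ⟨
    suc (n + n) C n + suc (n + n) C suc n               ≡⟨ cong (suc (n + n) C n +_) symmetric ⟩
    suc (n + n) C n + suc (n + n) C n                   ≡⟨ cong (suc (n + n) C n +_) (+-identityʳ _) ⟨
    2 * (suc (n + n) C n)                               ∎
    where
    open ≡-Reasoning
    symmetric : suc (n + n) C suc n ≡ suc (n + n) C n
    symmetric = trans (nCk≡nC[n∸k] (s≤s (m≤n+m n n))) (cong (suc (n + n) C_) (m+n∸m≡n n n))

  [2n+1]Cn≤4^n : ∀ n → suc (n + n) C n ≤ 4 ^ n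
  [2n+1]Cn≤4^n zero    = ≤-refl
  [2n+1]Cn≤4^n (suc n) = *-cancelˡ-≤ 2 (begin
    2 * (suc (suc n + suc n) C suc n) ≡⟨ centralBinom-suc≡2*[2n+1]Cn (suc n) ⟨
    centralBinom (suc (suc n))        ≤⟨ centralBinom-suc≤4*centralBinom (suc n) ⟩
    4 * centralBinom (suc n)          ≡⟨ cong (4 *_) (centralBinom-suc≡2*[2n+1]Cn n) ⟩
    4 * (2 * (suc (n + n) C n))       ≤⟨ *-monoʳ-≤ 4 (*-monoʳ-≤ 2 ([2n+1]Cn≤4^n n)) ⟩
    4 * (2 * 4 ^ n)                   ≡⟨ x∙yz≈y∙xz 4 2 (4 ^ n) ⟩
    2 * (4 * 4 ^ n)                   ∎)
    where
    open ≤-Reasoning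

  -- Valuations of factorials and of central binomial coefficients

  module Valuation (p : ℕ) (p-prime : Prime p) where

    instance
      p≢0 : NonZero p
      p≢0 = prime⇒nonZero p-prime

    1<p : 1 < p
    1<p = nonTrivial⇒n>1 p {{prime⇒nonTrivial p-prime}}

    record HasValuation (x v : ℕ) : Set where
      constructor valuation
      field
        cofactor     : ℕ
        factorises   : x ≡ p ^ v * cofactor
        p∤cofactor   : ¬ p ∣ cofactor

    p∤1 : ¬ p ∣ 1
    p∤1 p∣1 = <⇒≢ 1<p (sym (∣1⇒≡1 p∣1))

    p^k∣p^v*u⇒k≤v : ∀ {k v u} → ¬ p ∣ u → p ^ k ∣ p ^ v * u → k ≤ v
    p^k∣p^v*u⇒k≤v {k} {v} {u} p∤u p^k∣ with k ≤? v
    ... | yes k≤v = k≤v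
    ... | no  k≰v = ⊥-elim (p∤u (*-cancelˡ-∣ (p ^ v) {{m^n≢0 p v}}
            (subst (_∣ p ^ v * u) p^[1+v]≡p^v*p (∣-trans (^-monoʳ-∣ (≰⇒> k≰v)) p^k∣))))
      where
      p^[1+v]≡p^v*p : p ^ suc v ≡ p ^ v * p
      p^[1+v]≡p^v*p = *-comm p (p ^ v)
      ^-monoʳ-∣ : ∀ {a b} → a ≤ b → p ^ a ∣ p ^ b
      ^-monoʳ-∣ {a} a≤b = divides (p ^ (_ ∸ a))
        (trans (cong (p ^_) (sym (m∸n+n≡m a≤b))) (^-distribˡ-+-* p (_ ∸ a) a))

    p^k∣⇒k≤valuation : ∀ {x v k} → HasValuation x v → p ^ k ∣ x → k ≤ v
    p^k∣⇒k≤valuation (valuation u refl p∤u) = p^k∣p^v*u⇒k≤v p∤u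

    p^v∣x : ∀ {x v} → HasValuation x v → p ^ v ∣ x
    p^v∣x (valuation u refl _) = m∣m*n u

    valuation-unique : ∀ {x v w} → HasValuation x v → HasValuation x w → v ≡ w
    valuation-unique {w = w} x=p^v*u@(valuation u refl _) x=p^w*u′@(valuation u′ eq _) = ≤-antisym
      (p^k∣⇒k≤valuation x=p^w*u′ (m∣m*n u))
      (p^k∣⇒k≤valuation x=p^v*u (subst (p ^ w ∣_) (sym eq) (m∣m*n u′)))

    valuation-* : ∀ {x y v w} → HasValuation x v → HasValuation y w → HasValuation (x * y) (v + w)
    valuation-* {v = v} {w} (valuation u refl p∤u) (valuation u′ refl p∤u′) = valuation
      (u * u′)
      (trans (regroup (p ^ v) (p ^ w) u u′) (cong (_* (u * u′)) (sym (^-distribˡ-+-* p v w))))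
      λ p∣uu′ → [ p∤u , p∤u′ ]′ (euclidsLemma u u′ p-prime p∣uu′)
      where
      regroup : ∀ a b c d → a * c * (b * d) ≡ a * b * (c * d)
      regroup = solve-∀

    valuation-p^k : ∀ k → HasValuation (p ^ k) k
    valuation-p^k k = valuation 1 (sym (*-identityʳ (p ^ k))) p∤1

    valuation-coprime : ∀ {u} → ¬ p ∣ u → HasValuation u 0
    valuation-coprime {u} p∤u = valuation u (sym (+-identityʳ u)) p∤u

    valuation-exists : ∀ x → 0 < x → ∃ (HasValuation x)
    valuation-exists = <-rec _ step
      where
      step : ∀ x → (∀ {y} → y < x → 0 < y → ∃ (HasValuation y)) → 0 < x → ∃ (HasValuation x)
      step x rec 0<x with p ∣? x
      ... | no  p∤x = 0 , valuation-coprime p∤x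
      ... | yes p∣x@(divides y refl) with rec y<x 0<y
        where
        0<y : 0 < y
        0<y = n≢0⇒n>0 λ { refl → <-irrefl refl 0<x }
        y<x : y < y * p
        y<x = subst (_< y * p) (*-identityʳ y) (*-monoʳ-< y {{>-nonZero 0<y}} 1<p)
      ... | v , y=p^v*u = suc v ,
        subst (λ x → HasValuation x (suc v)) (trans (cong (_* y) (*-identityʳ p)) (*-comm p y))
          (valuation-* (valuation-p^k 1) y=p^v*u)

    Decomposes! : ℕ → ℕ → Set
    Decomposes! m k = ∃ λ R → m ! ≡ p ^ k * k ! * R × ¬ p ∣ R

    [k*p]!-decomposes : ∀ k → Decomposes! (k * p) k
    [r+k*p]!-decomposes : ∀ k r → r < p → Decomposes! (r + k * p) k
    [k*p]!-decomposes zero = 1 , refl , p∤1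
    [k*p]!-decomposes (suc k) with [r+k*p]!-decomposes k (pred p) (m≤pred[n]⇒suc[m]≤n ≤-refl)
    ... | R , eq , p∤R = R , (begin
      (p + k * p) !                         ≡⟨ cong (λ q → (q + k * p) !) (sym (suc-pred p)) ⟩
      (suc (pred p) + k * p) * (pred p + k * p) ! ≡⟨ cong₂ _*_ (cong (_+ k * p) (suc-pred p)) eq ⟩
      (p + k * p) * (p ^ k * k ! * R)       ≡⟨ regroup p k (p ^ k) (k !) R ⟩
      p ^ suc k * suc k ! * R               ∎) , p∤R
      where
      open ≡-Reasoning
      regroup : ∀ p k x f R → (p + k * p) * (x * f * R) ≡ p * x * ((1 + k) * f) * R
      regroup = solve-∀
    [r+k*p]!-decomposes k zero    _     = [k*p]!-decomposes k
    [r+k*p]!-decomposes k (suc r) 1+r<p with [r+k*p]!-decomposes k r (<-trans (n<1+n r) 1+r<p)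
    ... | R , eq , p∤R = (suc r + k * p) * R ,
      trans (cong ((suc r + k * p) *_) eq) (x∙yz≈y∙xz (suc r + k * p) (p ^ k * k !) R) ,
      λ p∣ → [ p∤1+r+k*p , p∤R ]′ (euclidsLemma _ R p-prime p∣)
      where
      p∤1+r+k*p : ¬ p ∣ suc r + k * p
      p∤1+r+k*p p∣ = <⇒≱ 1+r<p (∣⇒≤ (∣m+n∣m⇒∣n (subst (p ∣_) (+-comm (suc r) (k * p)) p∣) (n∣m*n k)))

    m!-decomposes : ∀ m → Decomposes! m (m / p)
    m!-decomposes m = subst (λ n → Decomposes! n (m / p)) (sym (m≡m%n+[m/n]*n m p))
      ([r+k*p]!-decomposes (m / p) (m % p) (m%n<n m p))

    ν! : ℕ → ℕ
    ν! m = proj₁ (valuation-exists (m !) (1≤n! m))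

    ν!-spec : ∀ m → HasValuation (m !) (ν! m)
    ν!-spec m = proj₂ (valuation-exists (m !) (1≤n! m))

    ν!-rec : ∀ m → ν! m ≡ m / p + ν! (m / p)
    ν!-rec m with m!-decomposes m
    ... | R , m!≡ , p∤R = valuation-unique (ν!-spec m)
      (subst₂ HasValuation (sym m!≡) (+-identityʳ _)
        (valuation-* (valuation-* (valuation-p^k (m / p)) (ν!-spec (m / p))) (valuation-coprime p∤R)))

    ν!-small : ∀ {m} → m < p → ν! m ≡ 0
    ν!-small {m} m<p = begin
      ν! m                 ≡⟨ ν!-rec m ⟩
      m / p + ν! (m / p)   ≡⟨ cong (λ k → k + ν! k) (m<n⇒m/n≡0 m<p) ⟩
      ν! 0                 ≡⟨ valuation-unique (ν!-spec 0) (valuation-coprime p∤1) ⟩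
      0                    ∎
      where open ≡-Reasoning

    -- Kummer: ν! (m + n + δ) - ν! m - ν! n counts the carries in the base-p addition m + n + δ,
    -- each at most one; below p ^ (e + 1) there are e + 1 digits and the top one cannot carry.
    ν![m+n+δ]≤ν!m+ν!n+e : ∀ e m n δ → δ ≤ 1 → m + n + δ < p ^ suc e → ν! (m + n + δ) ≤ ν! m + ν! n + e
    ν![m+n+δ]≤ν!m+ν!n+e zero m n δ _ l<p^1 = ≤-trans (≤-reflexive (ν!-small l<p)) z≤n
      where l<p = subst (m + n + δ <_) (*-identityʳ p) l<p^1
    ν![m+n+δ]≤ν!m+ν!n+e (suc e) m n δ δ≤1 l<p^[2+e] with [m+n+δ]/d≡m/d+n/d+carry m n δ p δ≤1
    ... | c , c≤1 , l/p≡ = begin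
      ν! (m + n + δ)                                 ≡⟨ ν!-rec (m + n + δ) ⟩
      (m + n + δ) / p + ν! ((m + n + δ) / p)         ≡⟨ cong (λ k → k + ν! k) l/p≡ ⟩
      m / p + n / p + c + ν! (m / p + n / p + c)     ≤⟨ +-monoʳ-≤ _ IH ⟩
      m / p + n / p + c + (ν! (m / p) + ν! (n / p) + e)
        ≡⟨ regroup (m / p) (n / p) c (ν! (m / p)) (ν! (n / p)) e ⟩
      (m / p + ν! (m / p)) + (n / p + ν! (n / p)) + (c + e)
        ≤⟨ +-monoʳ-≤ _ (+-monoˡ-≤ e c≤1) ⟩
      (m / p + ν! (m / p)) + (n / p + ν! (n / p)) + suc e
        ≡⟨ cong₂ (λ x y → x + y + suc e) (ν!-rec m) (ν!-rec n) ⟨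
      ν! m + ν! n + suc e                            ∎
      where
      open ≤-Reasoning
      IH : ν! (m / p + n / p + c) ≤ ν! (m / p) + ν! (n / p) + e
      IH = ν![m+n+δ]≤ν!m+ν!n+e e (m / p) (n / p) c c≤1
        (subst (_< p ^ suc e) l/p≡ (m<n*o⇒m/o<n (subst (m + n + δ <_) (*-comm p _) l<p^[2+e])))
      regroup : ∀ x y c X Y e → x + y + c + (X + Y + e) ≡ (x + X) + (y + Y) + (c + e)
      regroup = solve-∀

    e+2ν!n≤ν![2n] : ∀ {n e} → p ^ e ∣ centralBinom n → e + (ν! n + ν! n) ≤ ν! (n + n)
    e+2ν!n≤ν![2n] {n} {e} p^e∣B = p^k∣⇒k≤valuation (ν!-spec (n + n))
      (subst₂ _∣_ (sym (^-distribˡ-+-* p e _)) (centralBinom*n!*n!≡[2n]! n)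
        (*-pres-∣ p^e∣B (p^v∣x (valuation-* (ν!-spec n) (ν!-spec n)))))

    p^e∣centralBinom⇒p^e≤2n : ∀ {n e} → 0 < n → p ^ e ∣ centralBinom n → p ^ e ≤ n + n
    p^e∣centralBinom⇒p^e≤2n {n} {zero}  0<n _ = ≤-trans 0<n (m≤m+n n n)
    p^e∣centralBinom⇒p^e≤2n {n} {suc e} 0<n p^e∣B with p ^ suc e ≤? n + n
    ... | yes p^e≤2n = p^e≤2n
    ... | no  p^e≰2n = ⊥-elim (<-irrefl refl (begin-strict
      e + (ν! n + ν! n)   <⟨ e+2ν!n≤ν![2n] {n} {suc e} p^e∣B ⟩
      ν! (n + n)          ≡⟨ cong ν! (+-identityʳ (n + n)) ⟨
      ν! (n + n + 0)      ≤⟨ ν![m+n+δ]≤ν!m+ν!n+e e n n 0 z≤n 2n+0<p^[1+e] ⟩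
      ν! n + ν! n + e     ≡⟨ +-comm (ν! n + ν! n) e ⟩
      e + (ν! n + ν! n)   ∎))
      where
      open ≤-Reasoning
      2n+0<p^[1+e] : n + n + 0 < p ^ suc e
      2n+0<p^[1+e] = subst (_< p ^ suc e) (sym (+-identityʳ (n + n))) (≰⇒> p^e≰2n)

    p∤centralBinom : ∀ {n} → 3 ≤ p → p ≤ n → n + n < 3 * p → ¬ p ∣ centralBinom n
    p∤centralBinom {n} 3≤p p≤n 2n<3p p∣B = <-irrefl refl (subst₂ _≤_ ν!n≡1 ν![2n]≡2 3≤ν![2n])
      where
      3≤ν![2n] : 1 + (ν! n + ν! n) ≤ ν! (n + n)
      3≤ν![2n] = e+2ν!n≤ν![2n] {n} {1} (subst (_∣ centralBinom n) (sym (*-identityʳ p)) p∣B)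
      n<2p : n < 2 * p
      n<2p = +-cancelʳ-< p n (2 * p) (begin-strict
        n + p       ≤⟨ +-monoʳ-≤ n p≤n ⟩
        n + n       <⟨ 2n<3p ⟩
        3 * p       ≡⟨ solve (p ∷ []) ⟩
        2 * p + p   ∎)
        where open ≤-Reasoning
      ν!n≡1 : 1 + (ν! n + ν! n) ≡ 3
      ν!n≡1 = cong (λ k → 1 + (k + k)) (begin
        ν! n                ≡⟨ ν!-rec n ⟩
        n / p + ν! (n / p)  ≡⟨ cong (λ k → k + ν! k) (m/n≡k (subst (_≤ n) (sym (*-identityˡ p)) p≤n) n<2p) ⟩
        1 + ν! 1            ≡⟨ cong suc (ν!-small 1<p) ⟩
        1                   ∎)
        where open ≡-Reasoning
      ν![2n]≡2 : ν! (n + n) ≡ 2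
      ν![2n]≡2 = begin
        ν! (n + n)                    ≡⟨ ν!-rec (n + n) ⟩
        (n + n) / p + ν! ((n + n) / p) ≡⟨ cong (λ k → k + ν! k) (m/n≡k 2p≤2n 2n<3p) ⟩
        2 + ν! 2                      ≡⟨ cong (2 +_) (ν!-small 3≤p) ⟩
        2                             ∎
        where
        open ≡-Reasoning
        2p≤2n : 2 * p ≤ n + n
        2p≤2n = subst (_≤ n + n) (cong (p +_) (sym (+-identityʳ p))) (+-mono-≤ p≤n p≤n)

  -- Unlike if_then_else_ on does d, this can be abstracted by `with d` (does (r ≤? X) reduces to r ≤ᵇ X).
  ifᵈ_then_else_ : ∀ {P : Set} → Dec P → ℕ → ℕ → ℕ
  ifᵈ yes _ then a else b = a
  ifᵈ no  _ then a else b = b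

  ∏ : ℕ → (ℕ → ℕ) → ℕ
  ∏ zero    f = 1
  ∏ (suc X) f = ∏ X f * f (suc X)

  count : ∀ {P : Pred ℕ 0ℓ} → Decidable P → ℕ → ℕ
  count P? zero    = 0
  count P? (suc X) = count P? X + (ifᵈ P? (suc X) then 1 else 0)

  ∏-* : ∀ X f g → ∏ X (λ r → f r * g r) ≡ ∏ X f * ∏ X g
  ∏-* zero    f g = refl
  ∏-* (suc X) f g = trans (cong (_* (f (suc X) * g (suc X))) (∏-* X f g))
    (regroup (∏ X f) (∏ X g) (f (suc X)) (g (suc X)))
    where
    regroup : ∀ a b c d → a * b * (c * d) ≡ a * c * (b * d)
    regroup = solve-∀

  ∏-mono-≤ : ∀ X {f g} → (∀ r → 1 ≤ r → r ≤ X → f r ≤ g r) → ∏ X f ≤ ∏ X g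
  ∏-mono-≤ zero    f≤g = ≤-refl
  ∏-mono-≤ (suc X) f≤g =
    *-mono-≤ (∏-mono-≤ X λ r 1≤r r≤X → f≤g r 1≤r (m≤n⇒m≤1+n r≤X)) (f≤g (suc X) (s≤s z≤n) ≤-refl)

  ∏-cong : ∀ X {f g} → (∀ r → r ≤ X → f r ≡ g r) → ∏ X f ≡ ∏ X g
  ∏-cong zero    f≡g = refl
  ∏-cong (suc X) f≡g = cong₂ _*_ (∏-cong X λ r r≤X → f≡g r (m≤n⇒m≤1+n r≤X)) (f≡g (suc X) ≤-refl)

  ∏-ones : ∀ {X Y f} → X ≤ Y → (∀ r → X < r → f r ≡ 1) → ∏ Y f ≡ ∏ X f
  ∏-ones {Y = zero}      z≤n ones = refl
  ∏-ones {X} {suc Y} {f} X≤1+Y ones with m≤n⇒m<n∨m≡n X≤1+Y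
  ... | inj₂ refl       = refl
  ... | inj₁ (s≤s X≤Y) =
    trans (cong (∏ Y f *_) (ones (suc Y) (s≤s X≤Y))) (trans (*-identityʳ _) (∏-ones X≤Y ones))

  ∏-if : ∀ {P : Pred ℕ 0ℓ} (P? : Decidable P) X c → ∏ X (λ r → ifᵈ P? r then c else 1) ≡ c ^ count P? X
  ∏-if P? zero    c = refl
  ∏-if P? (suc X) c with P? (suc X)
  ... | yes _ = trans (cong (_* c) (∏-if P? X c)) (trans (*-comm (c ^ count P? X) c) (cong (c ^_) (+-comm 1 (count P? X))))
  ... | no  _ = trans (*-identityʳ _) (trans (∏-if P? X c) (cong (c ^_) (sym (+-identityʳ (count P? X)))))

  ∏ₚ : ℕ → (ℕ → ℕ) → ℕ
  ∏ₚ X g = ∏ X (λ r → ifᵈ prime? r then g r else 1)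

  prime≥2 : ∀ {r} → Prime r → 2 ≤ r
  prime≥2 {r} r-prime = nonTrivial⇒n>1 r {{prime⇒nonTrivial r-prime}}

  prime-divisor : ∀ m → 2 ≤ m → ∃ λ r → Prime r × r ∣ m
  prime-divisor m 2≤m with factorise m {{>-nonZero (<-trans z<s 2≤m)}}
  ... | record { factors = [] ; isFactorisation = m≡1 } = ⊥-elim (<⇒≱ 2≤m (≤-reflexive m≡1))
  ... | record { factors = r ∷ rs ; isFactorisation = eq ; factorsPrime = r-prime All.∷ _ } =
    r , r-prime , subst (r ∣_) (sym eq) (m∣m*n (product rs))

  ≤∏ₚ : ∀ X g m → 0 < m → (∀ r → Prime r → r ∣ m → r ≤ X) →
        (∀ r e → Prime r → r ^ e ∣ m → r ^ e ≤ g r) → m ≤ ∏ₚ X g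
  ≤∏ₚ zero g m 0<m divisors≤ _ with m ≤? 1
  ... | yes m≤1 = m≤1
  ... | no  m≰1 with prime-divisor m (≰⇒> m≰1)
  ...   | r , r-prime , r∣m = ⊥-elim (<⇒≱ (prime≥2 r-prime) (≤-trans (divisors≤ r r-prime r∣m) z≤n))
  ≤∏ₚ (suc X) g m 0<m divisors≤ powers≤ with prime? (suc X)
  ... | no ¬prime = subst (m ≤_) (sym (*-identityʳ _)) (≤∏ₚ X g m 0<m divisors≤X powers≤)
    where
    divisors≤X : ∀ r → Prime r → r ∣ m → r ≤ X
    divisors≤X r r-prime r∣m with m≤n⇒m<n∨m≡n (divisors≤ r r-prime r∣m)
    ... | inj₁ r<1+X = ≤-pred r<1+X
    ... | inj₂ refl  = ⊥-elim (¬prime r-prime)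
  ... | yes q-prime with Valuation.valuation-exists (suc X) q-prime m 0<m
  ...   | a , Valuation.valuation m′ m≡q^a*m′ q∤m′ = begin
    m                          ≡⟨ m≡m′*q^a ⟩
    m′ * q ^ a                 ≤⟨ *-mono-≤ (≤∏ₚ X g m′ 0<m′ divisors≤X powers≤′) (powers≤ q a q-prime (divides m′ m≡m′*q^a)) ⟩
    ∏ₚ X g * g q               ∎
    where
    open ≤-Reasoning
    q = suc X
    m≡m′*q^a : m ≡ m′ * q ^ a
    m≡m′*q^a = trans m≡q^a*m′ (*-comm (q ^ a) m′)
    m′∣m : m′ ∣ m
    m′∣m = divides (q ^ a) m≡q^a*m′
    0<m′ : 0 < m′
    0<m′ = n≢0⇒n>0 λ { refl → <⇒≢ 0<m (sym (trans m≡q^a*m′ (*-zeroʳ (q ^ a)))) }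
    divisors≤X : ∀ r → Prime r → r ∣ m′ → r ≤ X
    divisors≤X r r-prime r∣m′ with m≤n⇒m<n∨m≡n (divisors≤ r r-prime (∣-trans r∣m′ m′∣m))
    ... | inj₁ r<1+X = ≤-pred r<1+X
    ... | inj₂ refl  = ⊥-elim (q∤m′ r∣m′)
    powers≤′ : ∀ r e → Prime r → r ^ e ∣ m′ → r ^ e ≤ g r
    powers≤′ r e r-prime r^e∣m′ = powers≤ r e r-prime (∣-trans r^e∣m′ m′∣m)

  ∏-∣ : ∀ X {f M} → (∀ r → r ≤ X → f r ≡ 1 ⊎ (Prime r × f r ≡ r × r ∣ M)) → ∏ X f ∣ M
  ∏-∣ zero    _       = 1∣ _
  ∏-∣ (suc X) {f} {M} factors with ∏-∣ X {f} {M} (λ r r≤X → factors r (m≤n⇒m≤1+n r≤X)) | factors (suc X) ≤-refl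
  ... | ∏∣M | inj₁ f[1+X]≡1 = subst (_∣ M) (sym (trans (cong (∏ X f *_) f[1+X]≡1) (*-identityʳ _))) ∏∣M
  ... | ∏∣M@(divides k M≡k*∏) | inj₂ (q-prime , f[1+X]≡q , q∣M) =
    subst (_∣ M) (cong (∏ X f *_) (sym f[1+X]≡q)) (subst (∏ X f * suc X ∣_) (sym M≡∏*k) (*-monoʳ-∣ (∏ X f) q∣k))
    where
    M≡∏*k : M ≡ ∏ X f * k
    M≡∏*k = trans M≡k*∏ (*-comm k (∏ X f))
    q∤∏ : ∀ Y → Y ≤ X → ¬ suc X ∣ ∏ Y f
    q∤∏ zero    _   q∣1 = <⇒≱ (prime≥2 q-prime) (∣⇒≤ q∣1)
    q∤∏ (suc Y) Y<X q∣∏ with euclidsLemma (∏ Y f) (f (suc Y)) q-prime q∣∏ | factors (suc Y) (m≤n⇒m≤1+n Y<X)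
    ... | inj₁ q∣∏Y | _                      = q∤∏ Y (≤-trans (n≤1+n Y) Y<X) q∣∏Y
    ... | inj₂ q∣f  | inj₁ f≡1               = <⇒≱ (prime≥2 q-prime) (∣⇒≤ (subst (suc X ∣_) f≡1 q∣f))
    ... | inj₂ q∣f  | inj₂ (_ , f≡r , _)     = <⇒≱ (s≤s Y<X) (∣⇒≤ (subst (suc X ∣_) f≡r q∣f))
    q∣k : suc X ∣ k
    q∣k with euclidsLemma (∏ X f) k q-prime (subst (suc X ∣_) M≡∏*k q∣M)
    ... | inj₁ q∣∏ = ⊥-elim (q∤∏ X ≤-refl q∣∏)
    ... | inj₂ q∣k = q∣k

  ∏ₚ≤∏ : ∀ X f → (∀ r → 1 ≤ f r) → ∏ₚ X f ≤ ∏ X f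
  ∏ₚ≤∏ X f 1≤f = ∏-mono-≤ X pointwise
    where
    pointwise : ∀ r → 1 ≤ r → r ≤ X → (ifᵈ prime? r then f r else 1) ≤ f r
    pointwise r _ _ with prime? r
    ... | yes _ = ≤-refl
    ... | no  _ = 1≤f r

  ∏ₚ-if : ∀ {P : Pred ℕ 0ℓ} (P? : Decidable P) X c →
          ∏ₚ X (λ r → ifᵈ P? r then c else 1) ≡ c ^ count (λ r → prime? r ×-dec P? r) X
  ∏ₚ-if P? X c = trans (∏-cong X λ r _ → both r) (∏-if (λ r → prime? r ×-dec P? r) X c)
    where
    both : ∀ r → (ifᵈ prime? r then (ifᵈ P? r then c else 1) else 1) ≡ (ifᵈ prime? r ×-dec P? r then c else 1)
    both r with prime? r | P? r
    ... | yes _ | yes _ = refl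
    ... | yes _ | no  _ = refl
    ... | no  _ | _     = refl

  _↾≤_ : (ℕ → ℕ) → ℕ → ℕ → ℕ
  (g ↾≤ X) r = ifᵈ r ≤? X then g r else 1

  _↾>_ : (ℕ → ℕ) → ℕ → ℕ → ℕ
  (g ↾> X) r = ifᵈ r ≤? X then 1 else g r

  ∏ₚ-* : ∀ X f g → ∏ₚ X (λ r → f r * g r) ≡ ∏ₚ X f * ∏ₚ X g
  ∏ₚ-* X f g = trans (∏-cong X λ r _ → split r) (∏-* X _ _)
    where
    split : ∀ r → (ifᵈ prime? r then f r * g r else 1) ≡ (ifᵈ prime? r then f r else 1) * (ifᵈ prime? r then g r else 1)
    split r with prime? r
    ... | yes _ = refl
    ... | no  _ = refl

  ∏ₚ-mono-≤ : ∀ X {f g} → (∀ r → Prime r → r ≤ X → f r ≤ g r) → ∏ₚ X f ≤ ∏ₚ X g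
  ∏ₚ-mono-≤ X {f} {g} f≤g = ∏-mono-≤ X pointwise
    where
    pointwise : ∀ r → 1 ≤ r → r ≤ X → (ifᵈ prime? r then f r else 1) ≤ (ifᵈ prime? r then g r else 1)
    pointwise r _ r≤X with prime? r
    ... | yes r-prime = f≤g r r-prime r≤X
    ... | no  _       = ≤-refl

  ∏ₚ-split : ∀ Y X g → ∏ₚ Y g ≡ ∏ₚ Y (g ↾≤ X) * ∏ₚ Y (g ↾> X)
  ∏ₚ-split Y X g = trans (∏-cong Y λ r _ → cong (ifᵈ prime? r then_else 1) (sym (split r))) (∏ₚ-* Y _ _)
    where
    split : ∀ r → (g ↾≤ X) r * (g ↾> X) r ≡ g r
    split r with r ≤? X
    ... | yes _ = *-identityʳ (g r)
    ... | no  _ = +-identityʳ (g r)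

  ∏ₚ-↾≤ : ∀ {X Y} g → X ≤ Y → ∏ₚ Y (g ↾≤ X) ≡ ∏ₚ X g
  ∏ₚ-↾≤ {X} {Y} g X≤Y = trans (∏-ones X≤Y above) (∏-cong X below)
    where
    above : ∀ r → X < r → (ifᵈ prime? r then (g ↾≤ X) r else 1) ≡ 1
    above r X<r with prime? r | r ≤? X
    ... | no  _ | _     = refl
    ... | yes _ | no  _ = refl
    ... | yes _ | yes r≤X = ⊥-elim (<⇒≱ X<r r≤X)
    below : ∀ r → r ≤ X → (ifᵈ prime? r then (g ↾≤ X) r else 1) ≡ (ifᵈ prime? r then g r else 1)
    below r r≤X with prime? r | r ≤? X
    ... | no  _ | _     = refl
    ... | yes _ | yes _ = refl
    ... | yes _ | no r≰X = ⊥-elim (r≰X r≤X)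

  -- The primorial bound

  primorial : ℕ → ℕ
  primorial X = ∏ₚ X id

  prime∤k! : ∀ {q} → Prime q → ∀ {k} → k < q → ¬ q ∣ k !
  prime∤k! q-prime {zero}  _   q∣1 = <⇒≱ (prime≥2 q-prime) (∣⇒≤ q∣1)
  prime∤k! q-prime {suc k} k<q q∣k! with euclidsLemma (suc k) (k !) q-prime q∣k!
  ... | inj₁ q∣1+k = <⇒≱ k<q (∣⇒≤ q∣1+k)
  ... | inj₂ q∣k!  = prime∤k! q-prime (<-trans (n<1+n k) k<q) q∣k!

  prime∣[2m+1]Cm : ∀ {m q} → Prime q → suc m < q → q ≤ suc (m + m) → q ∣ suc (m + m) C m
  prime∣[2m+1]Cm {m} {q} q-prime m+1<q q≤2m+1
    with euclidsLemma (suc (m + m) C m) (m ! * suc m !) q-prime (subst (q ∣_) (sym C*m!*[m+1]!≡[2m+1]!) q∣[2m+1]!)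
    where
    C*m!*[m+1]!≡[2m+1]! : (suc (m + m) C m) * (m ! * suc m !) ≡ suc (m + m) !
    C*m!*[m+1]!≡[2m+1]! = subst (λ j → (suc (m + m) C m) * (m ! * j !) ≡ suc (m + m) !) (m+n∸n≡m (suc m) m)
      (nCk*k!*[n∸k]!≡n! (≤-trans (m≤m+n m m) (n≤1+n _)))
    q∣[2m+1]! : q ∣ suc (m + m) !
    q∣[2m+1]! = ∣-trans (n∣n! (prime⇒nonZero q-prime)) (m≤n⇒m!∣n! q≤2m+1)
      where
      n∣n! : ∀ {n} → NonZero n → n ∣ n !
      n∣n! {suc n} _ = m∣m*n (n !)
  ... | inj₁ q∣C = q∣C
  ... | inj₂ q∣m!*[m+1]! with euclidsLemma (m !) (suc m !) q-prime q∣m!*[m+1]!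
  ...   | inj₁ q∣m!     = ⊥-elim (prime∤k! q-prime (<-trans (n<1+n m) m+1<q) q∣m!)
  ...   | inj₂ q∣[m+1]! = ⊥-elim (prime∤k! q-prime m+1<q q∣[m+1]!)

  primorial[2m+1]≤primorial[m+1]*4^m : ∀ m → primorial (suc (m + m)) ≤ primorial (suc m) * 4 ^ m
  primorial[2m+1]≤primorial[m+1]*4^m m = begin
    primorial (suc (m + m))                                  ≡⟨ ∏ₚ-split (suc (m + m)) (suc m) id ⟩
    ∏ₚ (suc (m + m)) (id ↾≤ suc m) * ∏ₚ (suc (m + m)) (id ↾> suc m)
      ≡⟨ cong (_* ∏ₚ (suc (m + m)) (id ↾> suc m)) (∏ₚ-↾≤ id (s≤s (m≤m+n m m))) ⟩
    primorial (suc m) * ∏ₚ (suc (m + m)) (id ↾> suc m)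
      ≤⟨ *-monoʳ-≤ (primorial (suc m)) (∣⇒≤ {{>-nonZero C>0}} (∏-∣ (suc (m + m)) large-primes∣C)) ⟩
    primorial (suc m) * (suc (m + m) C m)                    ≤⟨ *-monoʳ-≤ (primorial (suc m)) ([2n+1]Cn≤4^n m) ⟩
    primorial (suc m) * 4 ^ m                                ∎
    where
    open ≤-Reasoning
    C>0 : 0 < suc (m + m) C m
    C>0 = nCk>0 (≤-trans (m≤m+n m m) (n≤1+n _))
    large-primes∣C : ∀ r → r ≤ suc (m + m) → (ifᵈ prime? r then (id ↾> suc m) r else 1) ≡ 1 ⊎
      (Prime r × (ifᵈ prime? r then (id ↾> suc m) r else 1) ≡ r × r ∣ suc (m + m) C m)
    large-primes∣C r r≤2m+1 with prime? r | r ≤? suc m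
    ... | no  _       | _       = inj₁ refl
    ... | yes _       | yes _   = inj₁ refl
    ... | yes r-prime | no r≰m+1 = inj₂ (r-prime , refl , prime∣[2m+1]Cm r-prime (≰⇒> r≰m+1) r≤2m+1)

  data Half : ℕ → Set where
    even : ∀ j → Half (j + j)
    odd  : ∀ j → Half (suc (j + j))

  half : ∀ n → Half n
  half zero = even zero
  half (suc n) with half n
  ... | even j = odd j
  ... | odd  j = subst Half (cong suc (+-suc j j)) (even (suc j))

  2+k+[2+k]-¬prime : ∀ k → ¬ Prime (suc (suc k) + suc (suc k))
  2+k+[2+k]-¬prime k isPrime with prime⇒irreducible isPrime (divides (suc (suc k)) (solve (k ∷ [])))
  ... | inj₁ ()
  ... | inj₂ 2≡2+k+[2+k] = m+1+n≢0 k (sym (suc-injective (suc-injective 2≡2+k+[2+k])))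

  primorial≤4^ : ∀ X → primorial X ≤ 4 ^ X
  primorial≤4^ = <-rec _ go
    where
    go : ∀ X → (∀ {Y} → Y < X → primorial Y ≤ 4 ^ Y) → primorial X ≤ 4 ^ X
    go X rec with half X
    go .(zero + zero)                 rec | even zero          = ≤-refl
    go .(1 + 1)                       rec | even (suc zero)    = s≤s (s≤s z≤n)
    go .(suc (suc k) + suc (suc k))   rec | even (suc (suc k)) with prime? (suc (suc k) + suc (suc k))
    ... | yes isPrime = ⊥-elim (2+k+[2+k]-¬prime k isPrime)
    ... | no  _     = begin
      primorial (suc (k + suc (suc k))) * 1  ≡⟨ *-identityʳ _ ⟩
      primorial (suc (k + suc (suc k)))      ≤⟨ rec ≤-refl ⟩
      4 ^ suc (k + suc (suc k))              ≤⟨ ^-monoʳ-≤ 4 (n≤1+n (suc (k + suc (suc k)))) ⟩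
      4 ^ (suc (suc k) + suc (suc k))        ∎
      where open ≤-Reasoning
    go .(suc (zero + zero))           rec | odd zero           = s≤s z≤n
    go .(suc (suc m + suc m))         rec | odd (suc m)        = begin
      primorial (suc (suc m + suc m))        ≤⟨ primorial[2m+1]≤primorial[m+1]*4^m (suc m) ⟩
      primorial (suc (suc m)) * 4 ^ suc m    ≤⟨ *-monoˡ-≤ (4 ^ suc m) (rec (s≤s (s≤s (m≤n+m (suc m) m)))) ⟩
      4 ^ suc (suc m) * 4 ^ suc m            ≡⟨ ^-distribˡ-+-* 4 (suc (suc m)) (suc m) ⟨
      4 ^ suc (suc m + suc m)                ∎
      where open ≤-Reasoning

  -- Erdős's bound for the central binomial coefficient

  π⟨_,_] : ℕ → ℕ → ℕ
  π⟨ n , X ] = count (λ r → prime? r ×-dec n <? r) X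

  count-≤ : ∀ S X → count (_≤? S) X ≤ S
  count-≤ S X = proj₂ (≤X×≤S X)
    where
    ≤X×≤S : ∀ X → count (_≤? S) X ≤ X × count (_≤? S) X ≤ S
    ≤X×≤S zero = z≤n , z≤n
    ≤X×≤S (suc X) with ≤X×≤S X | suc X ≤? S
    ... | ≤X , _  | yes 1+X≤S = ≤1+X , ≤-trans ≤1+X 1+X≤S
      where ≤1+X = subst (_≤ suc X) (+-comm 1 _) (s≤s ≤X)
    ... | ≤X , ≤S | no  _     = subst (λ c → c ≤ suc X × c ≤ S) (sym (+-identityʳ _)) (m≤n⇒m≤1+n ≤X , ≤S)

  r^e≤m<r*r⇒r^e≤r : ∀ {r e m} → 1 ≤ r → r ^ e ≤ m → m < r * r → r ^ e ≤ r
  r^e≤m<r*r⇒r^e≤r {r} {zero}        1≤r _ _ = 1≤r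
  r^e≤m<r*r⇒r^e≤r {r} {suc zero}    _   _ _ = ≤-reflexive (*-identityʳ r)
  r^e≤m<r*r⇒r^e≤r {r} {suc (suc e)} 1≤r r^e≤m m<r*r = ⊥-elim (<⇒≱ m<r*r (begin
    r * r                ≤⟨ *-monoʳ-≤ r (m≤m*n r (r ^ e) {{m^n≢0 r e {{>-nonZero 1≤r}}}}) ⟩
    r * (r * r ^ e)      ≤⟨ r^e≤m ⟩
    _                    ∎))
    where open ≤-Reasoning

  module Erdős (n : ℕ) (3≤n : 3 ≤ n) (S M : ℕ)
    (≤S : ∀ r → r * r ≤ n + n → r ≤ S) (≤M : ∀ r → 3 * r ≤ n + n → r ≤ M) (3M≤2n : 3 * M ≤ n + n) where

    0<2n : 0 < n + n
    0<2n = ≤-trans (<-trans z<s (s≤s (s≤s z≤n))) (≤-trans 3≤n (m≤m+n n n))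

    instance
      2n≢0 : NonZero (n + n)
      2n≢0 = >-nonZero 0<2n

    -- Erdős's case split: a prime r ≤ √2n contributes at most 2n to C(2n, n), a prime r ≤ 2n/3
    -- at most r, a prime in (2n/3, n] nothing, and a prime in (n, 2n] at most r.
    prime-power-bound : ℕ → ℕ
    prime-power-bound r =
      ifᵈ r * r ≤? n + n then n + n else ifᵈ 3 * r ≤? n + n then r else ifᵈ r ≤? n then 1 else r

    prime∣centralBinom⇒≤2n : ∀ r → Prime r → r ∣ centralBinom n → r ≤ n + n
    prime∣centralBinom⇒≤2n r r-prime r∣B = subst (_≤ n + n) (*-identityʳ r)
      (Valuation.p^e∣centralBinom⇒p^e≤2n r r-prime {n} {1} (<-trans z<s 3≤n)
        (subst (_∣ centralBinom n) (sym (*-identityʳ r)) r∣B))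

    prime-power∣centralBinom⇒≤bound : ∀ r e → Prime r → r ^ e ∣ centralBinom n → r ^ e ≤ prime-power-bound r
    prime-power∣centralBinom⇒≤bound r e r-prime r^e∣B = bounded
      where
      r^e≤2n : r ^ e ≤ n + n
      r^e≤2n = Valuation.p^e∣centralBinom⇒p^e≤2n r r-prime {n} {e} (<-trans z<s 3≤n) r^e∣B
      r^e≤r : ¬ r * r ≤ n + n → r ^ e ≤ r
      r^e≤r r*r≰2n = r^e≤m<r*r⇒r^e≤r {r} {e} (<-trans z<s (prime≥2 r-prime)) r^e≤2n (≰⇒> r*r≰2n)
      3≤r : ¬ 3 * r ≤ n + n → 3 ≤ r
      3≤r 3r≰2n with 3 ≤? r
      ... | yes 3≤r = 3≤r
      ... | no  3≰r = ⊥-elim (3r≰2n (begin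
        3 * r    ≤⟨ *-monoʳ-≤ 3 (≤-pred (≰⇒> 3≰r)) ⟩
        6        ≤⟨ +-mono-≤ 3≤n 3≤n ⟩
        n + n    ∎))
        where open ≤-Reasoning
      bounded : r ^ e ≤ prime-power-bound r
      bounded with r * r ≤? n + n
      ... | yes _ = r^e≤2n
      ... | no r*r≰2n with 3 * r ≤? n + n | r ≤? n
      ...   | yes _    | _       = r^e≤r r*r≰2n
      ...   | no  _    | no  _   = r^e≤r r*r≰2n
      ...   | no 3r≰2n | yes r≤n =
        r∤B⇒r^k≤1 (Valuation.p∤centralBinom r r-prime (3≤r 3r≰2n) r≤n (≰⇒> 3r≰2n)) e r^e∣B
        where
        r∤B⇒r^k≤1 : ¬ r ∣ centralBinom n → ∀ k → r ^ k ∣ centralBinom n → r ^ k ≤ 1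
        r∤B⇒r^k≤1 _   zero    _     = ≤-refl
        r∤B⇒r^k≤1 r∤B (suc k) r^k∣B = ⊥-elim (r∤B (∣-trans (m∣m*n (r ^ k)) r^k∣B))

    centralBinom≤∏ₚ : centralBinom n ≤ ∏ₚ (n + n) prime-power-bound
    centralBinom≤∏ₚ = ≤∏ₚ (n + n) prime-power-bound (centralBinom n) (centralBinom>0 n)
      prime∣centralBinom⇒≤2n prime-power∣centralBinom⇒≤bound

    small medium large : ℕ → ℕ
    small r  = ifᵈ r ≤? S then n + n else 1
    medium   = id ↾≤ M
    large r  = ifᵈ n <? r then n + n else 1

    small≢0 : ∀ r → NonZero (small r)
    small≢0 r with r ≤? S
    ... | yes _ = 2n≢0
    ... | no  _ = _

    medium≢0 : ∀ r → NonZero r → NonZero (medium r)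
    medium≢0 r r≢0 with r ≤? M
    ... | yes _ = r≢0
    ... | no  _ = _

    large≢0 : ∀ r → NonZero (large r)
    large≢0 r with n <? r
    ... | yes _ = 2n≢0
    ... | no  _ = _

    bound≤small*medium*large : ∀ r → Prime r → r ≤ n + n → prime-power-bound r ≤ small r * medium r * large r
    bound≤small*medium*large r r-prime r≤2n = go
      where
      instance
        _ = small≢0 r
        _ = medium≢0 r (prime⇒nonZero r-prime)
        _ = large≢0 r
        _ = m*n≢0 (small r) (medium r)
        _ = m*n≢0 (small r * medium r) (large r)
      go : prime-power-bound r ≤ small r * medium r * large r
      go with r * r ≤? n + n
      ... | yes r*r≤2n = ≤-trans 2n≤small (≤-trans (m≤m*n (small r) (medium r)) (m≤m*n (small r * medium r) (large r)))
        where
        2n≤small : n + n ≤ small r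
        2n≤small with r ≤? S
        ... | yes _   = ≤-refl
        ... | no  r≰S = ⊥-elim (r≰S (≤S r r*r≤2n))
      ... | no _ with 3 * r ≤? n + n
      ...   | yes 3r≤2n = ≤-trans r≤medium (≤-trans (m≤n*m (medium r) (small r)) (m≤m*n (small r * medium r) (large r)))
        where
        r≤medium : r ≤ medium r
        r≤medium with r ≤? M
        ... | yes _   = ≤-refl
        ... | no  r≰M = ⊥-elim (r≰M (≤M r 3r≤2n))
      ...   | no _ with r ≤? n
      ...     | yes _ = >-nonZero⁻¹ (small r * medium r * large r)
      ...     | no r≰n = ≤-trans r≤large (m≤n*m (large r) (small r * medium r))
        where
        r≤large : r ≤ large r
        r≤large with n <? r
        ... | yes _   = r≤2n
        ... | no  n≮r = ⊥-elim (n≮r (≰⇒> r≰n))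

    centralBinom≤[2n]^S*primorial[M]*[2n]^π : centralBinom n ≤ (n + n) ^ S * primorial M * (n + n) ^ π⟨ n , n + n ]
    centralBinom≤[2n]^S*primorial[M]*[2n]^π = begin
      centralBinom n                                                ≤⟨ centralBinom≤∏ₚ ⟩
      ∏ₚ (n + n) prime-power-bound                                  ≤⟨ ∏ₚ-mono-≤ (n + n) bound≤small*medium*large ⟩
      ∏ₚ (n + n) (λ r → small r * medium r * large r)               ≡⟨ ∏ₚ-* (n + n) _ large ⟩
      ∏ₚ (n + n) (λ r → small r * medium r) * ∏ₚ (n + n) large
        ≡⟨ cong (_* ∏ₚ (n + n) large) (∏ₚ-* (n + n) small medium) ⟩
      ∏ₚ (n + n) small * ∏ₚ (n + n) medium * ∏ₚ (n + n) large
        ≤⟨ *-mono-≤ (*-mono-≤ ∏ₚsmall≤ (≤-reflexive (∏ₚ-↾≤ id M≤2n))) (≤-reflexive (∏ₚ-if (n <?_) (n + n) (n + n))) ⟩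
      (n + n) ^ S * primorial M * (n + n) ^ π⟨ n , n + n ]          ∎
      where
      open ≤-Reasoning
      M≤2n : M ≤ n + n
      M≤2n = ≤-trans (m≤m+n M (M + (M + 0))) 3M≤2n
      ∏ₚsmall≤ : ∏ₚ (n + n) small ≤ (n + n) ^ S
      ∏ₚsmall≤ = begin
        ∏ₚ (n + n) small                   ≤⟨ ∏ₚ≤∏ (n + n) small (λ r → >-nonZero⁻¹ (small r) {{small≢0 r}}) ⟩
        ∏ (n + n) small                    ≡⟨ ∏-if (_≤? S) (n + n) (n + n) ⟩
        (n + n) ^ count (_≤? S) (n + n)    ≤⟨ ^-monoʳ-≤ (n + n) (count-≤ S (n + n)) ⟩
        (n + n) ^ S                        ∎

  -- Many primes between n and 2n

  ^-cancelʳ-≤ : ∀ m {a b} → 1 < m → m ^ a ≤ m ^ b → a ≤ b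
  ^-cancelʳ-≤ m {a} {b} 1<m m^a≤m^b with a ≤? b
  ... | yes a≤b = a≤b
  ... | no  a≰b = ⊥-elim (<⇒≱ (^-monoʳ-< m 1<m (≰⇒> a≰b)) m^a≤m^b)

  n<2^n : ∀ n → n < 2 ^ n
  n<2^n zero    = z<s
  n<2^n (suc n) = begin-strict
    suc n          <⟨ s≤s (n<2^n n) ⟩
    suc (2 ^ n)    ≤⟨ +-monoˡ-≤ (2 ^ n) (m^n>0 2 n) ⟩
    2 ^ n + 2 ^ n  ≡⟨ cong (2 ^ n +_) (+-identityʳ (2 ^ n)) ⟨
    2 ^ suc n      ∎
    where open ≤-Reasoning

  6[2+2i]≤2^[1+i] : ∀ j → let i = 6 + j in 6 * suc (i + suc i) ≤ 2 ^ suc i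
  6[2+2i]≤2^[1+i] zero    = m≤m+n 84 44
  6[2+2i]≤2^[1+i] (suc j) = begin
    6 * suc (7 + j + suc (7 + j))                   ≤⟨ m≤m+n _ (72 + 12 * j) ⟩
    6 * suc (7 + j + suc (7 + j)) + (72 + 12 * j)   ≡⟨ solve (j ∷ []) ⟩
    2 * (6 * suc (6 + j + suc (6 + j)))             ≤⟨ *-monoʳ-≤ 2 (6[2+2i]≤2^[1+i] j) ⟩
    2 * 2 ^ suc (6 + j)                             ∎
    where open ≤-Reasoning

  ¬x*x≤1+E+E*x+2M+E*c : ∀ x E c M → 1 ≤ E → 6 * E ≤ x → c + 2 < x → 3 * M ≤ x * x →
                        ¬ (x * x ≤ suc E + E * x + 2 * M + E * c)
  ¬x*x≤1+E+E*x+2M+E*c x E c M 1≤E 6E≤x c+2<x 3M≤x*x x*x≤ = <-irrefl refl (begin-strict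
    x * x                          ≤⟨ +-cancelʳ-≤ (2 * (x * x)) _ _ 3x*x≤ ⟩
    3 * (E + 1) + 3 * E * x + 3 * E * c ≤⟨ +-monoˡ-≤ (3 * E * c) (+-monoˡ-≤ (3 * E * x) (*-monoʳ-≤ 3 (+-monoʳ-≤ E 1≤E))) ⟩
    3 * (E + E) + 3 * E * x + 3 * E * c ≡⟨ solve (x ∷ E ∷ c ∷ []) ⟩
    3 * E * (x + (c + 2))          <⟨ *-monoʳ-< (3 * E) {{>-nonZero (≤-trans 1≤E (m≤m+n E (E + (E + 0))))}} (+-monoʳ-< x c+2<x) ⟩
    3 * E * (x + x)                ≡⟨ solve (x ∷ E ∷ []) ⟩
    6 * E * x                      ≤⟨ *-monoˡ-≤ x 6E≤x ⟩
    x * x                          ∎)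
    where
    open ≤-Reasoning
    3x*x≤ : x * x + 2 * (x * x) ≤ 3 * (E + 1) + 3 * E * x + 3 * E * c + 2 * (x * x)
    3x*x≤ = begin
      x * x + 2 * (x * x)                                ≡⟨ solve (x ∷ []) ⟩
      3 * (x * x)                                        ≤⟨ *-monoʳ-≤ 3 x*x≤ ⟩
      3 * (suc E + E * x + 2 * M + E * c)                ≡⟨ solve (x ∷ E ∷ c ∷ M ∷ []) ⟩
      3 * (E + 1) + 3 * E * x + 3 * E * c + 2 * (3 * M)  ≤⟨ +-monoʳ-≤ (3 * (E + 1) + 3 * E * x + 3 * E * c) (*-monoʳ-≤ 2 3M≤x*x) ⟩
      3 * (E + 1) + 3 * E * x + 3 * E * c + 2 * (x * x)  ∎

  -- n = 2 ^ (2i + 1), so that 2n = 2 ^ E is the perfect square x * x.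
  module DyadicWindow (i : ℕ) where

    n x E M : ℕ
    n = 2 ^ (i + suc i)
    x = 2 ^ suc i
    E = suc (i + suc i)
    M = (n + n) / 3

    2n≡2^E : n + n ≡ 2 ^ E
    2n≡2^E = cong (n +_) (sym (+-identityʳ n))

    2n≡x*x : n + n ≡ x * x
    2n≡x*x = trans 2n≡2^E (^-distribˡ-+-* 2 (suc i) (suc i))

    r*r≤2n⇒r≤x : ∀ r → r * r ≤ n + n → r ≤ x
    r*r≤2n⇒r≤x r r*r≤2n with r ≤? x
    ... | yes r≤x = r≤x
    ... | no  r≰x = ⊥-elim (<⇒≱ (*-mono-< (≰⇒> r≰x) (≰⇒> r≰x)) (subst (r * r ≤_) 2n≡x*x r*r≤2n))

    3r≤2n⇒r≤M : ∀ r → 3 * r ≤ n + n → r ≤ M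
    3r≤2n⇒r≤M r 3r≤2n = subst (_≤ M) (m*n/n≡m r 3) (/-monoˡ-≤ 3 (subst (_≤ n + n) (*-comm 3 r) 3r≤2n))

    3M≤2n : 3 * M ≤ n + n
    3M≤2n = subst (_≤ n + n) (*-comm M 3) (m/n*n≤m (n + n) 3)

    3≤n : 1 ≤ i → 3 ≤ n
    3≤n 1≤i = ≤-trans (s≤s (s≤s (s≤s (z≤n {1})))) (^-monoʳ-≤ 2 (+-mono-≤ 1≤i (s≤s z≤n)))

    x*x≤1+E+E*x+2M+E*π : 1 ≤ i → x * x ≤ suc E + E * x + 2 * M + E * π⟨ n , n + n ]
    x*x≤1+E+E*x+2M+E*π 1≤i = ^-cancelʳ-≤ 2 (s≤s (s≤s z≤n)) (begin
      2 ^ (x * x)                                      ≡⟨ cong (2 ^_) (sym 2n≡x*x) ⟩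
      2 ^ (n + n)                                      ≡⟨ cong (λ m → 2 ^ (n + m)) (sym (+-identityʳ n)) ⟩
      2 ^ (2 * n)                                      ≡⟨ ^-*-assoc 2 2 n ⟨
      4 ^ n                                            ≤⟨ 4^n≤[2n+1]*centralBinom n ⟩
      (1 + n + n) * centralBinom n
        ≤⟨ *-mono-≤ 1+2n≤2^[1+E] (Erdős.centralBinom≤[2n]^S*primorial[M]*[2n]^π n (3≤n 1≤i) x M r*r≤2n⇒r≤x 3r≤2n⇒r≤M 3M≤2n) ⟩
      2 ^ suc E * ((n + n) ^ x * primorial M * (n + n) ^ c)
        ≤⟨ *-monoʳ-≤ (2 ^ suc E) (*-mono-≤ (*-mono-≤ (≤-reflexive (2n^k≡2^[E*k] x)) primorial[M]≤2^[2M])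
                                           (≤-reflexive (2n^k≡2^[E*k] c))) ⟩
      2 ^ suc E * (2 ^ (E * x) * 2 ^ (2 * M) * 2 ^ (E * c))   ≡⟨ collect (suc E) (E * x) (2 * M) (E * c) ⟩
      2 ^ (suc E + E * x + 2 * M + E * c)              ∎)
      where
      open ≤-Reasoning
      c = π⟨ n , n + n ]
      1+2n≤2^[1+E] : 1 + n + n ≤ 2 ^ suc E
      1+2n≤2^[1+E] = begin
        1 + (n + n)        ≤⟨ +-monoˡ-≤ (n + n) (m^n>0 2 E) ⟩
        2 ^ E + (n + n)    ≡⟨ cong (2 ^ E +_) (trans 2n≡2^E (sym (+-identityʳ (2 ^ E)))) ⟩
        2 ^ suc E          ∎
      primorial[M]≤2^[2M] : primorial M ≤ 2 ^ (2 * M)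
      primorial[M]≤2^[2M] = ≤-trans (primorial≤4^ M) (≤-reflexive (^-*-assoc 2 2 M))
      2n^k≡2^[E*k] : ∀ k → (n + n) ^ k ≡ 2 ^ (E * k)
      2n^k≡2^[E*k] k = trans (cong (_^ k) 2n≡2^E) (^-*-assoc 2 E k)
      collect : ∀ a b d f → 2 ^ a * (2 ^ b * 2 ^ d * 2 ^ f) ≡ 2 ^ (a + b + d + f)
      collect a b d f = sym (begin-equality
        2 ^ (a + b + d + f)              ≡⟨ ^-distribˡ-+-* 2 (a + b + d) f ⟩
        2 ^ (a + b + d) * 2 ^ f          ≡⟨ cong (_* 2 ^ f) (^-distribˡ-+-* 2 (a + b) d) ⟩
        2 ^ (a + b) * 2 ^ d * 2 ^ f      ≡⟨ cong (λ y → y * 2 ^ d * 2 ^ f) (^-distribˡ-+-* 2 a b) ⟩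
        2 ^ a * 2 ^ b * 2 ^ d * 2 ^ f    ≡⟨ reassoc (2 ^ a) (2 ^ b) (2 ^ d) (2 ^ f) ⟩
        2 ^ a * (2 ^ b * 2 ^ d * 2 ^ f)  ∎)
        where
        reassoc : ∀ a b d f → a * b * d * f ≡ a * (b * d * f)
        reassoc = solve-∀

  n[1+i]≡4n[i] : ∀ i → DyadicWindow.n (suc i) ≡ 4 * DyadicWindow.n i
  n[1+i]≡4n[i] i = trans (cong (2 ^_) (cong suc (+-suc i (suc i)))) (sym (*-assoc 2 2 (2 ^ (i + suc i))))

  i<n[i] : ∀ i → i < DyadicWindow.n i
  i<n[i] i = <-≤-trans (n<2^n i) (^-monoʳ-≤ 2 (m≤m+n i (suc i)))

  window-bracket : ∀ x → DyadicWindow.n 6 ≤ x → ∃ λ i → 6 ≤ i × DyadicWindow.n i ≤ x × x < DyadicWindow.n (suc i)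
  window-bracket x n₆≤x = search x (<-≤-trans (i<n[i] x) (^-monoʳ-≤ 2 (+-mono-≤ (m≤n+m x 6) (s≤s (m≤n+m x 6)))))
    where
    search : ∀ d → x < DyadicWindow.n (6 + d) → ∃ λ i → 6 ≤ i × DyadicWindow.n i ≤ x × x < DyadicWindow.n (suc i)
    search zero    x<n₆ = ⊥-elim (<⇒≱ x<n₆ n₆≤x)
    search (suc d) x<n[7+d] with x <? DyadicWindow.n (6 + d)
    ... | yes x<n[6+d] = search d x<n[6+d]
    ... | no  x≮n[6+d] = 6 + d , m≤m+n 6 d , ≮⇒≥ x≮n[6+d] , x<n[7+d]

  many-primes : ∀ L i → 6 ≤ i → L + 2 ≤ i → let n = DyadicWindow.n i in L < π⟨ n , n + n ]
  many-primes L i 6≤i L+2≤i with L <? π⟨ DyadicWindow.n i , DyadicWindow.n i + DyadicWindow.n i ]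
  ... | yes L<π = L<π
  ... | no  L≮π = ⊥-elim (¬x*x≤1+E+E*x+2M+E*c x E c M (s≤s z≤n) 6E≤x c+2<x (subst (3 * M ≤_) 2n≡x*x 3M≤2n)
    (x*x≤1+E+E*x+2M+E*π (≤-trans (s≤s z≤n) 6≤i)))
    where
    open DyadicWindow i
    c = π⟨ n , n + n ]
    6E≤x : 6 * E ≤ x
    6E≤x with m≤n⇒∃[o]m+o≡n 6≤i
    ... | j , refl = 6[2+2i]≤2^[1+i] j
    c+2<x : c + 2 < x
    c+2<x = ≤-trans (s≤s (≤-trans (+-monoˡ-≤ 2 (≮⇒≥ L≮π)) L+2≤i)) (<⇒≤ (n<2^n (suc i)))

  -- Gaps in the sequence of primes

  B^s*[B+s]≤[1+B]^s*B : ∀ B s → B ^ s * (B + s) ≤ suc B ^ s * B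
  B^s*[B+s]≤[1+B]^s*B B zero    = ≤-reflexive (+-identityʳ (B + 0))
  B^s*[B+s]≤[1+B]^s*B B (suc s) = begin
    B * B ^ s * (B + suc s)                 ≡⟨ split B (B ^ s) s ⟩
    B * (B ^ s * (B + s)) + B ^ s * B
      ≤⟨ +-mono-≤ (*-monoʳ-≤ B (B^s*[B+s]≤[1+B]^s*B B s)) (*-monoˡ-≤ B (^-monoˡ-≤ s (n≤1+n B))) ⟩
    B * (suc B ^ s * B) + suc B ^ s * B     ≡⟨ merge B (suc B ^ s) ⟩
    suc B * suc B ^ s * B                   ∎
    where
    open ≤-Reasoning
    split : ∀ B y s → B * y * (B + suc s) ≡ B * (y * (B + s)) + y * B
    split = solve-∀
    merge : ∀ B z → B * (z * B) + z * B ≡ suc B * z * B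
    merge = solve-∀

  2B^B≤[1+B]^B : ∀ B → 1 ≤ B → 2 * B ^ B ≤ suc B ^ B
  2B^B≤[1+B]^B B 1≤B = *-cancelʳ-≤ (2 * B ^ B) (suc B ^ B) B {{>-nonZero 1≤B}} (begin
    2 * B ^ B * B     ≡⟨ regroup B (B ^ B) ⟩
    B ^ B * (B + B)   ≤⟨ B^s*[B+s]≤[1+B]^s*B B B ⟩
    suc B ^ B * B     ∎)
    where
    open ≤-Reasoning
    regroup : ∀ B y → 2 * y * B ≡ y * (B + B)
    regroup = solve-∀

  module PrimeEnumeration (p : ℕ → ℕ) (p-enum : IsPrimeEnumeration p) where

    p-prime : ∀ n → Prime (p n)
    p-prime = proj₁ p-enum

    p-< : ∀ {m n} → m < n → p m < p n
    p-< {m} {n} = proj₁ (proj₂ p-enum) m n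

    p-onto : ∀ q → Prime q → ∃ λ n → p n ≡ q
    p-onto = proj₂ (proj₂ p-enum)

    p-≤ : ∀ {m n} → m ≤ n → p m ≤ p n
    p-≤ m≤n with m≤n⇒m<n∨m≡n m≤n
    ... | inj₁ m<n  = <⇒≤ (p-< m<n)
    ... | inj₂ refl = ≤-refl

    p-<⁻¹ : ∀ {m n} → p m < p n → m < n
    p-<⁻¹ {m} {n} p[m]<p[n] with m <? n
    ... | yes m<n = m<n
    ... | no  m≮n = ⊥-elim (<⇒≱ p[m]<p[n] (p-≤ (≮⇒≥ m≮n)))

    n<p[n] : ∀ n → n < p n
    n<p[n] zero    = <-trans z<s (prime≥2 (p-prime 0))
    n<p[n] (suc n) = <-≤-trans (s≤s (n<p[n] n)) (p-< (n<1+n n))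

    π⟨n,X]≡0 : ∀ {n X} → X ≤ n → π⟨ n , X ] ≡ 0
    π⟨n,X]≡0 {n} {zero}  _ = refl
    π⟨n,X]≡0 {n} {suc X} 1+X≤n with prime? (suc X) ×-dec n <? suc X
    ... | yes (_ , n<1+X) = ⊥-elim (<⇒≱ n<1+X 1+X≤n)
    ... | no  _           = trans (+-identityʳ _) (π⟨n,X]≡0 (≤-trans (n≤1+n X) 1+X≤n))

    p[k+π]≤X : ∀ {k n} X → p k ≤ n → n ≤ X → p (k + π⟨ n , X ]) ≤ X
    p[k+π]≤X {k} {n} zero    p[k]≤n n≤0 = subst (_≤ 0) (cong p (sym (+-identityʳ k))) (≤-trans p[k]≤n n≤0)
    p[k+π]≤X {k} {n} (suc X) p[k]≤n n≤1+X with n ≤? X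
    ... | no  n≰X = subst (λ j → p j ≤ suc X) (sym (trans (cong (k +_) (π⟨n,X]≡0 (≰⇒> n≰X))) (+-identityʳ k)))
                      (≤-trans p[k]≤n n≤1+X)
    ... | yes n≤X with prime? (suc X) ×-dec n <? suc X
    ...   | no  _ = subst (λ j → p (k + j) ≤ suc X) (sym (+-identityʳ _)) (m≤n⇒m≤1+n (p[k+π]≤X X p[k]≤n n≤X))
    ...   | yes (1+X-prime , _) with p-onto (suc X) 1+X-prime
    ...     | m , p[m]≡1+X = subst (λ j → p j ≤ suc X) (sym k+[π+1]≡1+k+π)
      (subst (p (suc (k + π)) ≤_) p[m]≡1+X (p-≤ (p-<⁻¹ (subst (p (k + π) <_) (sym p[m]≡1+X) (s≤s p[k+π]≤X′)))))
      where
      π = π⟨ n , X ]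
      p[k+π]≤X′ = p[k+π]≤X X p[k]≤n n≤X
      k+[π+1]≡1+k+π : k + (π + 1) ≡ suc (k + π)
      k+[π+1]≡1+k+π = trans (sym (+-assoc k π 1)) (+-comm (k + π) 1)

    p[k+j]≤X : ∀ {k n} X j → p k ≤ n → n ≤ X → j ≤ π⟨ n , X ] → p (k + j) ≤ X
    p[k+j]≤X X j p[k]≤n n≤X j≤π = ≤-trans (p-≤ (+-monoʳ-≤ _ j≤π)) (p[k+π]≤X X p[k]≤n n≤X)

    index-bracket : ∀ {K n} → p K ≤ n → ∃ λ m → K ≤ m × p m ≤ n × n < p (suc m)
    index-bracket {K} {n} p[K]≤n = search n (≤-trans (s≤s (m≤n+m n K)) (n<p[n] (K + n)))
      where
      search : ∀ d → n < p (K + d) → ∃ λ m → K ≤ m × p m ≤ n × n < p (suc m)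
      search zero    n<p[K+0] = ⊥-elim (<⇒≱ n<p[K+0] (subst (λ j → p j ≤ n) (sym (+-identityʳ K)) p[K]≤n))
      search (suc d) n<p[K+1+d] with p (K + d) ≤? n
      ... | yes p[K+d]≤n = K + d , m≤m+n K d , p[K+d]≤n , subst (λ j → n < p j) (+-suc K d) n<p[K+1+d]
      ... | no  p[K+d]≰n = search d (≰⇒> p[K+d]≰n)

    p[1+k]≤8p[k] : ∀ k → DyadicWindow.n 6 ≤ k → p (suc k) ≤ 8 * p k
    p[1+k]≤8p[k] k n₆≤k with window-bracket (p k) (≤-trans n₆≤k (<⇒≤ (n<p[n] k)))
    ... | i , 6≤i , n[i]≤p[k] , p[k]<n[1+i] = begin
      p (suc k)                       ≡⟨ cong p (+-comm 1 k) ⟩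
      p (k + 1)                       ≤⟨ p[k+j]≤X (n′ + n′) 1 (<⇒≤ p[k]<n[1+i]) (m≤m+n n′ n′) 0<π ⟩
      n′ + n′                         ≡⟨ cong (λ m → m + m) (n[1+i]≡4n[i] i) ⟩
      4 * DyadicWindow.n i + 4 * DyadicWindow.n i ≡⟨ *-distribʳ-+ (DyadicWindow.n i) 4 4 ⟨
      8 * DyadicWindow.n i            ≤⟨ *-monoʳ-≤ 8 n[i]≤p[k] ⟩
      8 * p k                         ∎
      where
      open ≤-Reasoning
      n′ = DyadicWindow.n (suc i)
      0<π : 0 < π⟨ n′ , n′ + n′ ]
      0<π = many-primes 0 (suc i) (m≤n⇒m≤1+n 6≤i) (s≤s (≤-trans (s≤s z≤n) 6≤i))

    module _ {B K : ℕ} (1≤B : 1 ≤ B) (ratio≥ : ∀ k → K ≤ k → suc B * p k ≤ B * p (suc k)) where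

      [1+B]^s*p[m]≤B^s*p[m+s] : ∀ m → K ≤ m → ∀ s → suc B ^ s * p m ≤ B ^ s * p (m + s)
      [1+B]^s*p[m]≤B^s*p[m+s] m K≤m zero    = ≤-reflexive (cong (λ j → p j + 0) (sym (+-identityʳ m)))
      [1+B]^s*p[m]≤B^s*p[m+s] m K≤m (suc s) = begin
        suc B * suc B ^ s * p m         ≡⟨ *-assoc (suc B) (suc B ^ s) (p m) ⟩
        suc B * (suc B ^ s * p m)       ≤⟨ *-monoʳ-≤ (suc B) ([1+B]^s*p[m]≤B^s*p[m+s] m K≤m s) ⟩
        suc B * (B ^ s * p (m + s))     ≡⟨ x∙yz≈y∙xz (suc B) (B ^ s) (p (m + s)) ⟩
        B ^ s * (suc B * p (m + s))     ≤⟨ *-monoʳ-≤ (B ^ s) (ratio≥ (m + s) (≤-trans K≤m (m≤m+n m s))) ⟩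
        B ^ s * (B * p (suc (m + s)))   ≡⟨ x∙yz≈y∙xz (B ^ s) B (p (suc (m + s))) ⟩
        B * (B ^ s * p (suc (m + s)))   ≡⟨ *-assoc B (B ^ s) _ ⟨
        B * B ^ s * p (suc (m + s))     ≡⟨ cong (λ j → B * B ^ s * p j) (+-suc m s) ⟨
        B * B ^ s * p (m + suc s)       ∎
        where open ≤-Reasoning

      2p[m]≤p[m+B] : ∀ m → K ≤ m → 2 * p m ≤ p (m + B)
      2p[m]≤p[m+B] m K≤m = *-cancelˡ-≤ (B ^ B) {{m^n≢0 B B {{>-nonZero 1≤B}}}} (begin
        B ^ B * (2 * p m)       ≡⟨ x∙yz≈y∙xz (B ^ B) 2 (p m) ⟩
        2 * (B ^ B * p m)       ≡⟨ *-assoc 2 (B ^ B) (p m) ⟨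
        2 * B ^ B * p m         ≤⟨ *-monoˡ-≤ (p m) (2B^B≤[1+B]^B B 1≤B) ⟩
        suc B ^ B * p m         ≤⟨ [1+B]^s*p[m]≤B^s*p[m+s] m K≤m B ⟩
        B ^ B * p (m + B)       ∎)
        where open ≤-Reasoning

    -- B steps of ratio ≥ 1 + 1/B at least double p, leaving room for at most B primes in (n, 2n].
    ¬eventually-ratio≥1+1/B : ∀ B → 1 ≤ B → ∀ K → ¬ (∀ k → K ≤ k → suc B * p k ≤ B * p (suc k))
    ¬eventually-ratio≥1+1/B B 1≤B K ratio≥ = crowded (index-bracket p[K]≤n)
      where
      i = 6 + (B + p K)
      n = DyadicWindow.n i
      p[K]≤n : p K ≤ n
      p[K]≤n = ≤-trans (m≤n+m (p K) (6 + B)) (≤-trans (≤-reflexive (+-assoc 6 B (p K))) (<⇒≤ (i<n[i] i)))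
      B<π : B < π⟨ n , n + n ]
      B<π = many-primes B i (m≤m+n 6 (B + p K))
        (≤-trans (≤-reflexive (+-comm B 2)) (+-mono-≤ (s≤s (s≤s (z≤n {4}))) (m≤m+n B (p K))))
      crowded : (∃ λ m → K ≤ m × p m ≤ n × n < p (suc m)) → ⊥
      crowded (m , K≤m , p[m]≤n , n<p[1+m]) = <-irrefl refl (begin-strict
        2 * n                   <⟨ *-monoʳ-< 2 n<p[1+m] ⟩
        2 * p (suc m)           ≤⟨ 2p[m]≤p[m+B] 1≤B ratio≥ (suc m) (m≤n⇒m≤1+n K≤m) ⟩
        p (suc m + B)           ≡⟨ cong p (+-suc m B) ⟨
        p (m + suc B)           ≤⟨ p[k+j]≤X (n + n) (suc B) p[m]≤n (m≤m+n n n) B<π ⟩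
        n + n                   ≡⟨ cong (n +_) (+-identityʳ n) ⟨
        2 * n                   ∎)
        where open ≤-Reasoning

  -- A rational limit of the partial sums

  -- partialSum p M = numerator p M / primorialP p M
  numerator : (ℕ → ℕ) → ℕ → ℕ
  numerator p zero    = 0
  numerator p (suc M) = (numerator p M + (p M ∸ 1)) * p M

  primorialP>0 : ∀ {p} → (∀ n → Prime (p n)) → ∀ M → 0 < primorialP p M
  primorialP>0 p-prime zero    = z<s
  primorialP>0 p-prime (suc M) = *-mono-≤ (primorialP>0 p-prime M) (<-trans z<s (prime≥2 (p-prime M)))

  c*[aP∸bI]<P : ∀ a b c P I → b * I ≤ a * P → a * (suc c * b * P) < (P + I * (suc c * b)) * b →
                suc c * (a * P ∸ b * I) < P
  c*[aP∸bI]<P a b c P I bI≤aP aP<[P+bI]b = bound (a * P ∸ b * I) (m∸n+n≡m bI≤aP)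
    where
    bound : ∀ Z → Z + b * I ≡ a * P → suc c * Z < P
    bound Z Z+bI≡aP =
      *-cancelʳ-< b (suc c * Z) P (+-cancelʳ-< (suc c * (b * I) * b) (suc c * Z * b) (P * b) (begin-strict
      suc c * Z * b + suc c * (b * I) * b    ≡⟨ solve (c ∷ Z ∷ b ∷ I ∷ []) ⟩
      suc c * (Z + b * I) * b                ≡⟨ cong (λ x → suc c * x * b) Z+bI≡aP ⟩
      suc c * (a * P) * b                    ≡⟨ solve (a ∷ b ∷ c ∷ P ∷ []) ⟩
      a * (suc c * b * P)                    <⟨ aP<[P+bI]b ⟩
      (P + I * (suc c * b)) * b              ≡⟨ solve (b ∷ c ∷ P ∷ I ∷ []) ⟩
      P * b + suc c * (b * I) * b            ∎))
      where open ≤-Reasoning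

  module RationalLimit (p : ℕ → ℕ) (p-enum : IsPrimeEnumeration p) (a b : ℕ) (1≤b : 1 ≤ b)
    (partialSum≤q : ∀ M → b * numerator p M ≤ a * primorialP p M)
    (tail→0 : ∀ c N → 0 < c → ∃ λ M → N ≤ M × c * (a * primorialP p M ∸ b * numerator p M) < primorialP p M)
    where

    open PrimeEnumeration p p-enum

    -- With q = a / b, Z M / b = primorialP p M * (q - partialSum p M) is the paper's f (M + 1),
    -- and W M / b below is its fractional part f (M + 1) - p M.
    P I Z s : ℕ → ℕ
    P = primorialP p
    I = numerator p
    Z M = a * P M ∸ b * I M
    s M = p M ∸ 1

    1+s≡p : ∀ M → suc (s M) ≡ p M
    1+s≡p M = trans (+-comm 1 (s M)) (m∸n+n≡m (<⇒≤ (prime≥2 (p-prime M))))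

    instance
      p≢0 : ∀ {M} → NonZero (p M)
      p≢0 {M} = prime⇒nonZero (p-prime M)

    Z+bI≡aP : ∀ M → Z M + b * I M ≡ a * P M
    Z+bI≡aP M = m∸n+n≡m (partialSum≤q M)

    Z-rec : ∀ M → Z (suc M) + b * (p M * s M) ≡ p M * Z M
    Z-rec M = +-cancelʳ-≡ (p M * (b * I M)) _ _ (begin
      Z (suc M) + b * (p M * s M) + p M * (b * I M)   ≡⟨ regroup (Z (suc M)) b (p M) (s M) (I M) ⟩
      Z (suc M) + b * I (suc M)                       ≡⟨ Z+bI≡aP (suc M) ⟩
      a * (P M * p M)                                 ≡⟨ trans (sym (*-assoc a (P M) (p M))) (*-comm (a * P M) (p M)) ⟩
      p M * (a * P M)                                 ≡⟨ cong (p M *_) (Z+bI≡aP M) ⟨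
      p M * (Z M + b * I M)                           ≡⟨ *-distribˡ-+ (p M) (Z M) (b * I M) ⟩
      p M * Z M + p M * (b * I M)                     ∎)
      where
      open ≡-Reasoning
      regroup : ∀ z b p s i → z + b * (p * s) + p * (b * i) ≡ z + b * ((i + s) * p)
      regroup = solve-∀


    p[M]≤s[1+M] : ∀ M → p M ≤ s (suc M)
    p[M]≤s[1+M] M = ≤-pred (subst (p M <_) (sym (1+s≡p (suc M))) (p-< (n<1+n M)))

    p*[b*p]≡b*p+b*[p*s] : ∀ M → p M * (b * p M) ≡ b * p M + b * (p M * s M)
    p*[b*p]≡b*p+b*[p*s] M = subst (λ q → q * (b * q) ≡ b * q + b * (q * s M)) (1+s≡p M) (expand b (s M))
      where
      expand : ∀ b s → suc s * (b * suc s) ≡ b * suc s + b * (suc s * s)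
      expand = solve-∀

    b*s≤Z : ∀ M → b * s M ≤ Z M
    b*s≤Z M = *-cancelˡ-≤ (p M) (begin
      p M * (b * s M)              ≡⟨ x∙yz≈y∙xz (p M) b (s M) ⟩
      b * (p M * s M)              ≤⟨ m≤n+m _ (Z (suc M)) ⟩
      Z (suc M) + b * (p M * s M)  ≡⟨ Z-rec M ⟩
      p M * Z M                    ∎)
      where open ≤-Reasoning

    b*p≤Z : ∀ M → b * p M ≤ Z M
    b*p≤Z M = *-cancelˡ-≤ (p M) (begin
      p M * (b * p M)                  ≡⟨ p*[b*p]≡b*p+b*[p*s] M ⟩
      b * p M + b * (p M * s M)        ≤⟨ +-monoˡ-≤ _ (≤-trans (*-monoʳ-≤ b (p[M]≤s[1+M] M)) (b*s≤Z (suc M))) ⟩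
      Z (suc M) + b * (p M * s M)      ≡⟨ Z-rec M ⟩
      p M * Z M                        ∎)
      where open ≤-Reasoning

    b*p<Z : ∀ M → b * p M < Z M
    b*p<Z M with b * p M <? Z M
    ... | yes b*p<Z = b*p<Z
    ... | no  b*p≮Z = ⊥-elim (<⇒≱ (*-monoʳ-< b {{>-nonZero 1≤b}} (p-< (n<1+n M))) (≤-trans (b*p≤Z (suc M)) Z[1+M]≤b*p))
      where
      Z[1+M]≤b*p : Z (suc M) ≤ b * p M
      Z[1+M]≤b*p = +-cancelʳ-≤ (b * (p M * s M)) _ _ (begin
        Z (suc M) + b * (p M * s M)  ≡⟨ Z-rec M ⟩
        p M * Z M                    ≤⟨ *-monoʳ-≤ (p M) (≮⇒≥ b*p≮Z) ⟩
        p M * (b * p M)              ≡⟨ p*[b*p]≡b*p+b*[p*s] M ⟩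
        b * p M + b * (p M * s M)    ∎)
        where open ≤-Reasoning

    W : ℕ → ℕ
    W M = Z M ∸ b * p M

    W+b*p≡Z : ∀ M → W M + b * p M ≡ Z M
    W+b*p≡Z M = m∸n+n≡m (<⇒≤ (b*p<Z M))

    1≤W : ∀ M → 1 ≤ W M
    1≤W M = m<n⇒0<n∸m (b*p<Z M)

    W-rec : ∀ M → W (suc M) + b * p (suc M) ≡ p M * W M + b * p M
    W-rec M = +-cancelʳ-≡ (b * (p M * s M)) _ _ (begin
      W (suc M) + b * p (suc M) + b * (p M * s M)   ≡⟨ cong (_+ b * (p M * s M)) (W+b*p≡Z (suc M)) ⟩
      Z (suc M) + b * (p M * s M)                   ≡⟨ Z-rec M ⟩
      p M * Z M                                     ≡⟨ cong (p M *_) (W+b*p≡Z M) ⟨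
      p M * (W M + b * p M)                         ≡⟨ *-distribˡ-+ (p M) (W M) (b * p M) ⟩
      p M * W M + p M * (b * p M)                   ≡⟨ cong (p M * W M +_) (p*[b*p]≡b*p+b*[p*s] M) ⟩
      p M * W M + (b * p M + b * (p M * s M))       ≡⟨ +-assoc (p M * W M) (b * p M) _ ⟨
      p M * W M + b * p M + b * (p M * s M)         ∎)
      where open ≡-Reasoning

    K₁ K₂ : ℕ
    K₁ = DyadicWindow.n 6
    K₂ = K₁ + 14 * b

    14b+1≤p : ∀ k → K₂ ≤ k → 14 * b + 1 ≤ p k
    14b+1≤p k K₂≤k = begin
      14 * b + 1   ≡⟨ +-comm (14 * b) 1 ⟩
      suc (14 * b) ≤⟨ s≤s (≤-trans (m≤n+m (14 * b) K₁) K₂≤k) ⟩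
      suc k        ≤⟨ n<p[n] k ⟩
      p k          ∎
      where open ≤-Reasoning

    p*W≤W[1+M]+7b*p : ∀ M → K₁ ≤ M → p M * W M ≤ W (suc M) + 7 * b * p M
    p*W≤W[1+M]+7b*p M K₁≤M = +-cancelʳ-≤ (b * p M) _ _ (begin
      p M * W M + b * p M             ≡⟨ W-rec M ⟨
      W (suc M) + b * p (suc M)       ≤⟨ +-monoʳ-≤ (W (suc M)) (*-monoʳ-≤ b (p[1+k]≤8p[k] M K₁≤M)) ⟩
      W (suc M) + b * (8 * p M)       ≡⟨ split (W (suc M)) b (p M) ⟩
      W (suc M) + 7 * b * p M + b * p M ∎)
      where
      open ≤-Reasoning
      split : ∀ w b q → w + b * (8 * q) ≡ w + 7 * b * q + b * q
      split = solve-∀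

    module _ (k : ℕ) (K₂≤k : K₂ ≤ k) (7b<W : 7 * b < W k) where

      -- W (j + k) ≥ P (j + k) / (2 P k) + 7b + 1/2, cleared of denominators.
      W-grows : ∀ j → P (j + k) + P k * (14 * b + 1) ≤ P k * (2 * W (j + k))
      W-grows zero = begin
        P k + P k * (14 * b + 1)    ≡⟨ double (P k) b ⟩
        P k * (2 * suc (7 * b))     ≤⟨ *-monoʳ-≤ (P k) (*-monoʳ-≤ 2 7b<W) ⟩
        P k * (2 * W k)             ∎
        where
        open ≤-Reasoning
        double : ∀ x b → x + x * (14 * b + 1) ≡ x * (2 * suc (7 * b))
        double = solve-∀
      W-grows (suc j) = +-cancelʳ-≤ (P k * (14 * b * p M)) _ _ (begin
        P M * p M + P k * (14 * b + 1) + P k * (14 * b * p M)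
          ≤⟨ +-monoˡ-≤ _ (+-monoʳ-≤ (P M * p M) (*-monoʳ-≤ (P k) (14b+1≤p M K₂≤M))) ⟩
        P M * p M + P k * p M + P k * (14 * b * p M)   ≡⟨ factor (P M) (P k) (p M) b ⟩
        p M * (P M + P k * (14 * b + 1))               ≤⟨ *-monoʳ-≤ (p M) (W-grows j) ⟩
        p M * (P k * (2 * W M))                        ≡⟨ rearrange (p M) (P k) (W M) ⟩
        P k * 2 * (p M * W M)
          ≤⟨ *-monoʳ-≤ (P k * 2) (p*W≤W[1+M]+7b*p M (≤-trans (m≤m+n K₁ (14 * b)) K₂≤M)) ⟩
        P k * 2 * (W (suc M) + 7 * b * p M)            ≡⟨ distribute (P k) (W (suc M)) b (p M) ⟩
        P k * (2 * W (suc M)) + P k * (14 * b * p M)   ∎)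
        where
        open ≤-Reasoning
        M = j + k
        K₂≤M : K₂ ≤ M
        K₂≤M = ≤-trans K₂≤k (m≤n+m k j)
        factor : ∀ x y q b → x * q + y * q + y * (14 * b * q) ≡ q * (x + y * (14 * b + 1))
        factor = solve-∀
        rearrange : ∀ q x w → q * (x * (2 * w)) ≡ x * 2 * (q * w)
        rearrange = solve-∀
        distribute : ∀ x w b q → x * 2 * (w + 7 * b * q) ≡ x * (2 * w) + x * (14 * b * q)
        distribute = solve-∀

      P≤2P[k]Z : ∀ M → k ≤ M → P M ≤ 2 * P k * Z M
      P≤2P[k]Z M k≤M = begin
        P M                                   ≤⟨ m≤m+n (P M) (P k * (14 * b + 1)) ⟩
        P M + P k * (14 * b + 1)              ≡⟨ cong (λ j → P j + P k * (14 * b + 1)) (m∸n+n≡m k≤M) ⟨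
        P (M ∸ k + k) + P k * (14 * b + 1)    ≤⟨ W-grows (M ∸ k) ⟩
        P k * (2 * W (M ∸ k + k))             ≡⟨ cong (λ j → P k * (2 * W j)) (m∸n+n≡m k≤M) ⟩
        P k * (2 * W M)                       ≤⟨ *-monoʳ-≤ (P k) (*-monoʳ-≤ 2 (m≤m+n (W M) (b * p M))) ⟩
        P k * (2 * (W M + b * p M))           ≡⟨ cong (λ z → P k * (2 * z)) (W+b*p≡Z M) ⟩
        P k * (2 * Z M)                       ≡⟨ trans (x∙yz≈y∙xz (P k) 2 (Z M)) (sym (*-assoc 2 (P k) (Z M))) ⟩
        2 * P k * Z M                         ∎
        where open ≤-Reasoning

    W≤7b : ∀ k → K₂ ≤ k → W k ≤ 7 * b
    W≤7b k K₂≤k = ≮⇒≥ λ 7b<W → <⇒≱ 2P[k]Z<P (P≤2P[k]Z k K₂≤k 7b<W M k≤M)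
      where
      small-tail = tail→0 (2 * P k) k (≤-trans (primorialP>0 p-prime k) (m≤n*m (P k) 2))
      M = proj₁ small-tail
      k≤M = proj₁ (proj₂ small-tail)
      2P[k]Z<P = proj₂ (proj₂ small-tail)

    [1+2b]p≤2b*p[1+k] : ∀ k → K₂ ≤ k → suc (2 * b) * p k ≤ 2 * b * p (suc k)
    [1+2b]p≤2b*p[1+k] k K₂≤k = +-cancelˡ-≤ (14 * b) _ _ (begin
      14 * b + suc (2 * b) * p k          ≡⟨ expand₁ b (p k) ⟩
      14 * b + p k + 2 * b * p k
        ≤⟨ +-monoˡ-≤ (2 * b * p k) (+-monoˡ-≤ (p k) (≤-trans (m≤m+n (14 * b) 1) (14b+1≤p k K₂≤k))) ⟩
      p k + p k + 2 * b * p k             ≡⟨ expand₂ b (p k) ⟩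
      2 * (p k * 1 + b * p k)             ≤⟨ *-monoʳ-≤ 2 (+-monoˡ-≤ (b * p k) (*-monoʳ-≤ (p k) (1≤W k))) ⟩
      2 * (p k * W k + b * p k)           ≡⟨ cong (2 *_) (W-rec k) ⟨
      2 * (W (suc k) + b * p (suc k))     ≤⟨ *-monoʳ-≤ 2 (+-monoˡ-≤ (b * p (suc k)) (W≤7b (suc k) (m≤n⇒m≤1+n K₂≤k))) ⟩
      2 * (7 * b + b * p (suc k))         ≡⟨ expand₃ b (p (suc k)) ⟩
      14 * b + 2 * b * p (suc k)          ∎)
      where
      open ≤-Reasoning
      expand₁ : ∀ b q → 14 * b + suc (2 * b) * q ≡ 14 * b + q + 2 * b * q
      expand₁ = solve-∀
      expand₂ : ∀ b q → q + q + 2 * b * q ≡ 2 * (q * 1 + b * q)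
      expand₂ = solve-∀
      expand₃ : ∀ b q → 2 * (7 * b + b * q) ≡ 14 * b + 2 * b * q
      expand₃ = solve-∀

    absurd : ⊥
    absurd = ¬eventually-ratio≥1+1/B (2 * b) (≤-trans 1≤b (m≤m+n b (b + 0))) K₂ [1+2b]p≤2b*p[1+k]

module RationalPartialSums where

  open import Data.Nat as ℕ using (ℕ; zero; suc; pred; _∸_; z≤n; s≤s)
  import Data.Nat.Properties as ℕ
  open import Data.Nat.Tactic.RingSolver using (solve-∀)
  open import Data.Integer as ℤ using (+_; -[1+_])
  import Data.Integer.Properties as ℤ
  open import Data.Rational
  open import Data.Rational.Properties
  open import Data.Rational.Unnormalised as ℚᵘ using (ℚᵘ; mkℚᵘ; *≤*; *<*; *≡*)
  import Data.Rational.Unnormalised.Properties as ℚᵘ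
  open import Algebra.Properties.Group +-0-group using (⁻¹-anti-homo-//; //-rightDividesˡ; ⁻¹-involutive)
  open import Data.Product
  open import Data.Nat.Primality using (Prime)
  open import Data.Sum using (inj₁; inj₂)
  open import Data.Empty using (⊥-elim)
  open import Relation.Nullary
  open import Relation.Binary.PropositionalEquality

  x-y<ε⇒x<ε+y : ∀ {x y ε} → x - y < ε → x < ε + y
  x-y<ε⇒x<ε+y {x} {y} {ε} x-y<ε = subst (_< ε + y) (//-rightDividesˡ y x) (+-monoˡ-< y x-y<ε)

  -x≤∣x∣ : ∀ x → - x ≤ ∣ x ∣
  -x≤∣x∣ x with ∣p∣≡p∨∣p∣≡-p x
  ... | inj₂ ∣x∣≡-x = ≤-reflexive (sym ∣x∣≡-x)
  ... | inj₁ ∣x∣≡x  = ≤-trans (neg-antimono-≤ 0≤x) (≤-trans 0≤x (≤-reflexive (sym ∣x∣≡x)))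
    where 0≤x = ∣p∣≡p⇒0≤p ∣x∣≡x

  ∣x-y∣<ε⇒x<ε+y : ∀ {x y ε} → ∣ x - y ∣ < ε → x < ε + y
  ∣x-y∣<ε⇒x<ε+y {x} {y} ∣x-y∣<ε = x-y<ε⇒x<ε+y (≤-<-trans x-y≤∣x-y∣ ∣x-y∣<ε)
    where
    x-y≤∣x-y∣ : x - y ≤ ∣ x - y ∣
    x-y≤∣x-y∣ = subst₂ _≤_ (⁻¹-involutive (x - y)) (∣-p∣≡∣p∣ (x - y)) (-x≤∣x∣ (- (x - y)))

  ∣x-y∣<ε⇒y<ε+x : ∀ {x y ε} → ∣ x - y ∣ < ε → y < ε + x
  ∣x-y∣<ε⇒y<ε+x {x} {y} ∣x-y∣<ε =
    x-y<ε⇒x<ε+y (≤-<-trans (≤-reflexive (sym (⁻¹-anti-homo-// x y))) (≤-<-trans (-x≤∣x∣ (x - y)) ∣x-y∣<ε))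

  nonnegative⇒+a/b : ∀ {q} → 0ℚ ≤ q → ∃ λ a → ∃ λ d → toℚᵘ q ≡ mkℚᵘ (+ a) d
  nonnegative⇒+a/b {mkℚ (+ a)    d _} _         = a , d , refl
  nonnegative⇒+a/b {mkℚ -[1+ _ ] _ _} (*≤* ())

  frac≥0 : ∀ a d → 0ℚ ≤ frac a d
  frac≥0 a zero    = ≤-refl
  frac≥0 a (suc d) = nonNegative⁻¹ _ {{normalize-nonNeg a (suc d)}}

  partialSum-mono : ∀ p M k → partialSum p M ≤ partialSum p (k ℕ.+ M)
  partialSum-mono p M zero    = ≤-refl
  partialSum-mono p M (suc k) = ≤-trans (partialSum-mono p M k)
    (subst (_≤ partialSum p (suc k ℕ.+ M)) (+-identityʳ (partialSum p (k ℕ.+ M)))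
      (+-monoʳ-≤ (partialSum p (k ℕ.+ M)) (frac≥0 (p (k ℕ.+ M) ∸ 1) (primorialP p (k ℕ.+ M)))))

  Converges : (ℕ → ℕ) → ℚ → Set
  Converges p q = ∀ ε → 0ℚ < ε → ∃ λ N → ∀ n → n ℕ.≥ N → ∣ partialSum p n - q ∣ < ε

  partialSum≤limit : ∀ {p q} → Converges p q → ∀ M → partialSum p M ≤ q
  partialSum≤limit {p} {q} converges M with partialSum p M ≤? q
  ... | yes S≤q = S≤q
  ... | no  S≰q with converges (partialSum p M - q) 0<S-q
    where
    0<S-q : 0ℚ < partialSum p M - q
    0<S-q = subst (_< partialSum p M - q) (+-inverseʳ q) (+-monoˡ-< (- q) (≰⇒> S≰q))
  ...   | N , close = ⊥-elim (<-irrefl refl (<-≤-trans S[N+M]<S[M] (partialSum-mono p M N)))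
    where
    S[N+M]<S[M] : partialSum p (N ℕ.+ M) < partialSum p M
    S[N+M]<S[M] = subst (partialSum p (N ℕ.+ M) <_) (//-rightDividesˡ q (partialSum p M))
      (∣x-y∣<ε⇒x<ε+y (close (N ℕ.+ M) (ℕ.m≤m+n N M)))

  mkℚᵘ-≃ : ∀ {a b c d} → a ℕ.* suc d ≡ c ℕ.* suc b → mkℚᵘ (+ a) b ℚᵘ.≃ mkℚᵘ (+ c) d
  mkℚᵘ-≃ {a} {b} {c} {d} eq = *≡* (trans (sym (ℤ.pos-* a (suc d))) (trans (cong +_ eq) (ℤ.pos-* c (suc b))))

  mkℚᵘ-+ : ∀ a b c d →
           mkℚᵘ (+ a) b ℚᵘ.+ mkℚᵘ (+ c) d ℚᵘ.≃ mkℚᵘ (+ (a ℕ.* suc d ℕ.+ c ℕ.* suc b)) (d ℕ.+ b ℕ.* suc d)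
  mkℚᵘ-+ a b c d = *≡* (cong (ℤ._* + suc (d ℕ.+ b ℕ.* suc d)) (sym (cong₂ ℤ._+_ (ℤ.pos-* a (suc d)) (ℤ.pos-* c (suc b)))))

  mkℚᵘ-≤ : ∀ {a b c d} → mkℚᵘ (+ a) b ℚᵘ.≤ mkℚᵘ (+ c) d → a ℕ.* suc d ℕ.≤ c ℕ.* suc b
  mkℚᵘ-≤ {a} {b} {c} {d} (*≤* a*d≤c*b) =
    ℤ.drop‿+≤+ (subst₂ ℤ._≤_ (sym (ℤ.pos-* a (suc d))) (sym (ℤ.pos-* c (suc b))) a*d≤c*b)

  mkℚᵘ-< : ∀ {a b c d} → mkℚᵘ (+ a) b ℚᵘ.< mkℚᵘ (+ c) d → a ℕ.* suc d ℕ.< c ℕ.* suc b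
  mkℚᵘ-< {a} {b} {c} {d} (*<* a*d<c*b) =
    ℤ.drop‿+<+ (subst₂ ℤ._<_ (sym (ℤ.pos-* a (suc d))) (sym (ℤ.pos-* c (suc b))) a*d<c*b)

  frac≃ : ∀ a d → toℚᵘ (frac a (suc d)) ℚᵘ.≃ mkℚᵘ (+ a) d
  frac≃ a d = toℚᵘ-fromℚᵘ (mkℚᵘ (+ a) d)

  open NumberTheory using (numerator; primorialP>0; c*[aP∸bI]<P)

  module _ (p : ℕ → ℕ) (p-prime : ∀ n → Prime (p n)) where

    P I D : ℕ → ℕ
    P = primorialP p
    I = numerator p
    D M = pred (P M)

    1+D≡P : ∀ M → suc (D M) ≡ P M
    1+D≡P M = ℕ.suc-pred (P M) {{ℕ.>-nonZero (primorialP>0 p-prime M)}}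

    partialSum≃I/P : ∀ M → toℚᵘ (partialSum p M) ℚᵘ.≃ mkℚᵘ (+ I M) (D M)
    partialSum≃I/P zero    = ℚᵘ.≃-refl
    partialSum≃I/P (suc M) = begin
      toℚᵘ (partialSum p M + frac t (P M))                 ≈⟨ toℚᵘ-homo-+ (partialSum p M) (frac t (P M)) ⟩
      toℚᵘ (partialSum p M) ℚᵘ.+ toℚᵘ (frac t (P M))       ≈⟨ ℚᵘ.+-cong (partialSum≃I/P M) last-term ⟩
      mkℚᵘ (+ I M) (D M) ℚᵘ.+ mkℚᵘ (+ t) (D M)             ≈⟨ mkℚᵘ-+ (I M) (D M) t (D M) ⟩
      mkℚᵘ (+ (I M ℕ.* suc (D M) ℕ.+ t ℕ.* suc (D M))) (D M ℕ.+ D M ℕ.* suc (D M)) ≈⟨ mkℚᵘ-≃ cross ⟩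
      mkℚᵘ (+ I (suc M)) (D (suc M))                        ∎
      where
      open ℚᵘ.≃-Reasoning
      t = p M ∸ 1
      last-term : toℚᵘ (frac t (P M)) ℚᵘ.≃ mkℚᵘ (+ t) (D M)
      last-term = subst (λ x → toℚᵘ (frac t x) ℚᵘ.≃ mkℚᵘ (+ t) (D M)) (1+D≡P M) (frac≃ t (D M))
      cross : (I M ℕ.* suc (D M) ℕ.+ t ℕ.* suc (D M)) ℕ.* suc (D (suc M)) ≡ I (suc M) ℕ.* suc (D M ℕ.+ D M ℕ.* suc (D M))
      cross = trans (cong ((I M ℕ.* suc (D M) ℕ.+ t ℕ.* suc (D M)) ℕ.*_) (trans (1+D≡P (suc M)) (cong (ℕ._* p M) (sym (1+D≡P M)))))
        (regroup (I M) t (D M) (p M))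
        where
        regroup : ∀ i t d q → (i ℕ.* suc d ℕ.+ t ℕ.* suc d) ℕ.* (suc d ℕ.* q) ≡ (i ℕ.+ t) ℕ.* q ℕ.* (suc d ℕ.* suc d)
        regroup = solve-∀

    ≤q⇒b*I≤a*P : ∀ {M q a d} → toℚᵘ q ≡ mkℚᵘ (+ a) d → partialSum p M ≤ q → suc d ℕ.* I M ℕ.≤ a ℕ.* P M
    ≤q⇒b*I≤a*P {M} {a = a} {d} q≡a/b S≤q = subst₂ ℕ._≤_ (ℕ.*-comm (I M) (suc d)) (cong (a ℕ.*_) (1+D≡P M))
      (mkℚᵘ-≤ (ℚᵘ.≤-respˡ-≃ (partialSum≃I/P M) (subst (toℚᵘ (partialSum p M) ℚᵘ.≤_) q≡a/b (toℚᵘ-mono-≤ S≤q))))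

    q<ε+S⇒ : ∀ {M q a d e} → toℚᵘ q ≡ mkℚᵘ (+ a) d → q < frac 1 (suc e) + partialSum p M →
             a ℕ.* (suc e ℕ.* P M) ℕ.< (P M ℕ.+ I M ℕ.* suc e) ℕ.* suc d
    q<ε+S⇒ {M} {a = a} {d} {e} q≡a/b q<ε+S =
      subst₂ ℕ._<_ (cong (λ x → a ℕ.* (suc e ℕ.* x)) (1+D≡P M))
                   (cong (λ x → (x ℕ.+ I M ℕ.* suc e) ℕ.* suc d) (trans (ℕ.*-identityˡ _) (1+D≡P M)))
      (mkℚᵘ-< (ℚᵘ.<-respʳ-≃ ε+S≃ (subst (ℚᵘ._< toℚᵘ (frac 1 (suc e) + partialSum p M)) q≡a/b (toℚᵘ-mono-< q<ε+S))))
      where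
      ε+S≃ : toℚᵘ (frac 1 (suc e) + partialSum p M) ℚᵘ.≃
             mkℚᵘ (+ (1 ℕ.* suc (D M) ℕ.+ I M ℕ.* suc e)) (D M ℕ.+ e ℕ.* suc (D M))
      ε+S≃ = ℚᵘ.≃-trans (toℚᵘ-homo-+ (frac 1 (suc e)) (partialSum p M))
        (ℚᵘ.≃-trans (ℚᵘ.+-cong (frac≃ 1 e) (partialSum≃I/P M)) (mkℚᵘ-+ 1 e (I M) (D M)))

    tail→0 : ∀ {q a d} → toℚᵘ q ≡ mkℚᵘ (+ a) d → Converges p q → ∀ k N → 0 ℕ.< k →
             ∃ λ M → N ℕ.≤ M × k ℕ.* (a ℕ.* P M ∸ suc d ℕ.* I M) ℕ.< P M
    tail→0 {q} {a} {d} q≡a/b converges (suc k) N _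
      with converges (frac 1 (suc k ℕ.* suc d)) (positive⁻¹ _ {{normalize-pos 1 (suc k ℕ.* suc d)}})
    ... | N′ , close = N′ ℕ.+ N , ℕ.m≤n+m N N′ ,
      c*[aP∸bI]<P a (suc d) k (P M) (I M) (≤q⇒b*I≤a*P {M} q≡a/b (partialSum≤limit converges M))
        (q<ε+S⇒ {M} q≡a/b (∣x-y∣<ε⇒y<ε+x (close M (ℕ.m≤m+n N′ N))))
      where M = N′ ℕ.+ N

open import Data.Nat using (ℕ; _≥_)
open import Data.Rational using (ℚ; 0ℚ; _<_; _-_; ∣_∣)
open import Data.Product using (∃; proj₁; proj₂)
open import Relation.Nullary using (¬_)
open import Data.Nat using (suc; s≤s; z≤n)

theorem2 : (p : ℕ → ℕ) → IsPrimeEnumeration p →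
    (q : ℚ) → ¬ (∀ (ε : ℚ) → 0ℚ < ε → ∃ λ N → ∀ n → n ≥ N → ∣ partialSum p n - q ∣ < ε)
theorem2 p p-enum q converges =
  NumberTheory.RationalLimit.absurd p p-enum a (suc d) (s≤s z≤n)
    (λ M → ≤q⇒b*I≤a*P p p-prime {M} q≡a/b (partialSum≤limit converges M))
    (tail→0 p p-prime q≡a/b converges)
  where
  open RationalPartialSums
  p-prime = proj₁ p-enum
  q≥0 = partialSum≤limit converges 0
  a = proj₁ (nonnegative⇒+a/b q≥0)
  d = proj₁ (proj₂ (nonnegative⇒+a/b q≥0))
  q≡a/b = proj₂ (proj₂ (nonnegative⇒+a/b q≥0))
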